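{- For complex $q$ with $|q|<1$, \[ 1+ \sum_{n=1}^\infty (-1)^n (q^{5P_{5,n}} + q^{5Q_{5,n}})=\Big( \sum_{n=0}^\infty \frac{q^{n^2}}{(q;q)_n} \Big)\Big( 1+ \sum_{n=1}^\infty (-1)^n (q^{P_{7,n}} + q^{Q_{7,n}})\Big), \] where $P_{5,n}=\frac{n(3n-1)}{2}$, $Q_{5,n}=\frac{n(3n+1)}{2}$, $P_{7,n}=\frac{n(5n-3)}{2}$, $Q_{7,n}=\frac{n(5n+3)}{2}$.
   Context: $(a;q)_n=\prod_{k=0}^{n-1}(1-aq^k)$ for $n\ge1$ and $(a;q)_0=1$. In general, for $g>3$, $P_{g,n}=\frac{n((g-2)n-(g-4))}{2}$ and $Q_{g,n}=\frac{n((g-2)n+(g-4))}{2}$. -}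

module Defs where

open import Data.Nat as ℕ using (ℕ; zero; suc; _∸_; _≡ᵇ_; _%_)
import Data.Nat.DivMod
open import Data.Integer using (ℤ; _+_; _*_; -_; 0ℤ; 1ℤ)
open import Data.Bool using (if_then_else_)

-- Formal power series in q with integer coefficients: coefficient map.
PS : Set
PS = ℕ → ℤ

sumTo : ℕ → (ℕ → ℤ) → ℤ
sumTo zero    f = f 0
sumTo (suc N) f = sumTo N f + f (suc N)

_⊕_ : PS → PS → PS
(f ⊕ g) N = f N + g N

_⊗_ : PS → PS → PS
(f ⊗ g) N = sumTo N (λ i → f i * g (N ∸ i))

scale : ℤ → PS → PS
scale c f N = c * f N

qpow : ℕ → PS
qpow k N = if k ≡ᵇ N then 1ℤ else 0ℤ

one : PS
one = qpow 0

sgn : ℕ → ℤ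
sgn zero    = 1ℤ
sgn (suc n) = - sgn n

-- 1/(1 - q^(j+1)) = Σ_{m≥0} q^{(j+1)m}
invOneMinusQpow : ℕ → PS
invOneMinusQpow j N = if (N % suc j) ≡ᵇ 0 then 1ℤ else 0ℤ

invQPoch : ℕ → PS
invQPoch zero    = one
invQPoch (suc n) = invQPoch n ⊗ invOneMinusQpow n

-- Infinite sum Σ_{n≥0} F n of a family with ord(F n) ≥ n (locally finite):
-- coefficient of q^N only receives contributions from n ≤ N.
lsum : (ℕ → PS) → PS
lsum F N = sumTo N (λ n → F n N)

-- Generalized pentagonal-type exponents, g > 3
P : ℕ → ℕ → ℕ
P g n = (n ℕ.* ((g ∸ 2) ℕ.* n ∸ (g ∸ 4))) ℕ./ 2

Q : ℕ → ℕ → ℕ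
Q g n = (n ℕ.* ((g ∸ 2) ℕ.* n ℕ.+ (g ∸ 4))) ℕ./ 2

lhsTerm : ℕ → PS
lhsTerm zero    = one
lhsTerm (suc n) = scale (sgn (suc n)) (qpow (5 ℕ.* P 5 (suc n)) ⊕ qpow (5 ℕ.* Q 5 (suc n)))

LHS : PS
LHS = lsum lhsTerm

rrTerm : ℕ → PS
rrTerm n = qpow (n ℕ.* n) ⊗ invQPoch n

RR : PS
RR = lsum rrTerm

thetaTerm : ℕ → PS
thetaTerm zero    = one
thetaTerm (suc n) = scale (sgn (suc n)) (qpow (P 7 (suc n)) ⊕ qpow (Q 7 (suc n)))

Theta7 : PS
Theta7 = lsum thetaTerm

-- Everything happens in ℤ[[q]]; an infinite product is handled through its truncations, since
-- (q^s; q^b)_k no longer changes modulo q^(M+1) once k ≥ M.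
--
-- Jacobi's triple product: for b = a + c, the theta series Σ_{k ∈ ℤ} (-1)^k q^e(k), e(k) = b k(k-1)/2 + a k,
-- equals (q^a; q^b)_∞ (q^c; q^b)_∞ (q^b; q^b)_∞. Multiply the finite form
-- Σ_{j ≤ 2n} (-1)^(j-n) q^e(j-n) [2n, j]_(q^b) = (q^a; q^b)_n (q^c; q^b)_n, proved by induction on n with
-- the two q-Pascal rules, by (q^b; q^b)_n and let n → ∞: (q^b; q^b)_n [2n, j]_(q^b) → 1 for fixed j - n.
-- For (a, c) = (1, 4) and (5, 10) this gives Theta7 = (q, q^4, q^5; q^5)_∞ and LHS = (q^5; q^5)_∞.
--
-- Rogers–Ramanujan, after Rogers and Selberg: with G a = Σ_n q^(n² + a n) / (q; q)_n, both
-- (q^(a+1); q)_∞ G a and an explicit series W a (which for a = 0 is the theta series of (2, 3)) solve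
-- F a = (1 - q^(a+1)) F (a+1) + q^(a+1) (1 - q^(a+1)) (1 - q^(a+2)) F (a+2) with F a ≡ 1 modulo q^(a+1),
-- and these conditions determine F. Hence (q; q)_∞ RR = (q^2, q^3, q^5; q^5)_∞.
--
-- Multiplying, (q; q)_∞ RR Theta7 = (q; q)_∞ (q^5; q^5)_∞ = (q; q)_∞ LHS, and (q; q)_∞ has constant term 1.

module Submission where

open import Defs
open import Data.Nat as ℕ using (ℕ; zero; suc; _∸_; _≤_; _<_; z≤n; s≤s)
import Data.Nat.Properties as ℕP
import Data.Nat.DivMod as ℕD
open import Data.Nat.Tactic.RingSolver using (solve-∀)
open import Data.Integer as ℤ using (ℤ; _+_; _*_; -_; 0ℤ; 1ℤ)
import Data.Integer.Properties as ℤP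
open import Data.Bool using (if_then_else_)
open import Data.Maybe using (just; nothing)
open import Data.Product using (_,_)
open import Data.Sum using (_⊎_; inj₁; inj₂)
open import Function using (_∘_)
open import Relation.Nullary using (yes; no)
open import Relation.Binary.Definitions using (WeaklyDecidable)
open import Relation.Binary.Bundles using (Setoid)
open import Relation.Binary.PropositionalEquality hiding (J)
open import Algebra.Bundles using (AbelianGroup; CommutativeRing)
open import Algebra.Properties.Group (AbelianGroup.group ℤP.+-0-abelianGroup) using (∙-cancelʳ)
open import Algebra.Properties.CommutativeSemigroup ℤP.+-commutativeSemigroup using (interchange)
import Algebra.Solver.Ring.AlmostCommutativeRing as ACR
import Algebra.Solver.Ring
import Algebra.Solver.CommutativeMonoid
import Relation.Binary.Reasoning.Setoid

sumTo-cong : ∀ N {f g : ℕ → ℤ} → (∀ i → i ≤ N → f i ≡ g i) → sumTo N f ≡ sumTo N g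
sumTo-cong zero    f≗g = f≗g 0 z≤n
sumTo-cong (suc N) f≗g =
  cong₂ _+_ (sumTo-cong N (λ i i≤N → f≗g i (ℕP.m≤n⇒m≤1+n i≤N))) (f≗g (suc N) ℕP.≤-refl)

sumTo-suc : ∀ N (f : ℕ → ℤ) → sumTo (suc N) f ≡ f 0 + sumTo N (f ∘ suc)
sumTo-suc zero    f = refl
sumTo-suc (suc N) f =
  trans (cong (_+ f (suc (suc N))) (sumTo-suc N f)) (ℤP.+-assoc (f 0) (sumTo N (f ∘ suc)) _)

sumTo-+ : ∀ N (f g : ℕ → ℤ) → sumTo N (λ i → f i + g i) ≡ sumTo N f + sumTo N g
sumTo-+ zero    f g = refl
sumTo-+ (suc N) f g =
  trans (cong (_+ (f (suc N) + g (suc N))) (sumTo-+ N f g)) (interchange (sumTo N f) (sumTo N g) (f (suc N)) (g (suc N)))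

sumTo-*ˡ : ∀ N c (f : ℕ → ℤ) → c * sumTo N f ≡ sumTo N (λ i → c * f i)
sumTo-*ˡ zero    c f = refl
sumTo-*ˡ (suc N) c f =
  trans (ℤP.*-distribˡ-+ c (sumTo N f) (f (suc N))) (cong (_+ c * f (suc N)) (sumTo-*ˡ N c f))

sumTo-zero : ∀ N (f : ℕ → ℤ) → (∀ i → i ≤ N → f i ≡ 0ℤ) → sumTo N f ≡ 0ℤ
sumTo-zero zero    f f≗0 = f≗0 0 z≤n
sumTo-zero (suc N) f f≗0 =
  cong₂ _+_ (sumTo-zero N f (λ i i≤N → f≗0 i (ℕP.m≤n⇒m≤1+n i≤N))) (f≗0 (suc N) ℕP.≤-refl)

sumTo-pad : ∀ N d (f : ℕ → ℤ) → (∀ i → N < i → f i ≡ 0ℤ) → sumTo (N ℕ.+ d) f ≡ sumTo N f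
sumTo-pad N zero    f f≗0 = cong (λ k → sumTo k f) (ℕP.+-identityʳ N)
sumTo-pad N (suc d) f f≗0 = begin
  sumTo (N ℕ.+ suc d) f                 ≡⟨ cong (λ k → sumTo k f) (ℕP.+-suc N d) ⟩
  sumTo (N ℕ.+ d) f + f (suc (N ℕ.+ d)) ≡⟨ cong₂ _+_ (sumTo-pad N d f f≗0) (f≗0 _ (s≤s (ℕP.m≤m+n N d))) ⟩
  sumTo N f + 0ℤ                        ≡⟨ ℤP.+-identityʳ _ ⟩
  sumTo N f                             ∎
  where open ≡-Reasoning

-- The ring of formal power series

infix 4 _≋_
record _≋_ (f g : PS) : Set where
  constructor coeffwise
  field coeff : ∀ N → f N ≡ g N
open _≋_ public

≋-refl : ∀ {f} → f ≋ f
≋-refl = coeffwise λ _ → refl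

≋-sym : ∀ {f g} → f ≋ g → g ≋ f
≋-sym p = coeffwise λ N → sym (coeff p N)

≋-trans : ∀ {f g h} → f ≋ g → g ≋ h → f ≋ h
≋-trans p q = coeffwise λ N → trans (coeff p N) (coeff q N)

0ps : PS
0ps _ = 0ℤ

neg : PS → PS
neg f N = - f N

_⊖_ : PS → PS → PS
f ⊖ g = f ⊕ neg g

shiftDown : PS → PS
shiftDown f N = f (suc N)

⊗-suc : ∀ f g N → (f ⊗ g) (suc N) ≡ f 0 * g (suc N) + (shiftDown f ⊗ g) N
⊗-suc f g N = sumTo-suc N _

⊗-sucʳ : ∀ f g N → (f ⊗ g) (suc N) ≡ (f ⊗ shiftDown g) N + f (suc N) * g 0
⊗-sucʳ f g N = cong₂ _+_
  (sumTo-cong N (λ i i≤N → cong (λ k → f i * g k) (ℕP.+-∸-assoc 1 i≤N)))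
  (cong (λ k → f (suc N) * g k) (ℕP.n∸n≡0 N))

⊗-cong : ∀ {f f′ g g′} → f ≋ f′ → g ≋ g′ → f ⊗ g ≋ f′ ⊗ g′
⊗-cong f≋f′ g≋g′ = coeffwise λ N → sumTo-cong N (λ i _ → cong₂ _*_ (coeff f≋f′ i) (coeff g≋g′ (N ∸ i)))

⊕-cong : ∀ {f f′ g g′} → f ≋ f′ → g ≋ g′ → f ⊕ g ≋ f′ ⊕ g′
⊕-cong f≋f′ g≋g′ = coeffwise λ N → cong₂ _+_ (coeff f≋f′ N) (coeff g≋g′ N)

neg-cong : ∀ {f g} → f ≋ g → neg f ≋ neg g
neg-cong f≋g = coeffwise λ N → cong -_ (coeff f≋g N)

⊗-comm : ∀ f g → f ⊗ g ≋ g ⊗ f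
⊗-comm f g = coeffwise (go f g)
  where
  go : ∀ f g N → (f ⊗ g) N ≡ (g ⊗ f) N
  go f g zero    = ℤP.*-comm (f 0) (g 0)
  go f g (suc N) = begin
    (f ⊗ g) (suc N)                            ≡⟨ ⊗-suc f g N ⟩
    f 0 * g (suc N) + (shiftDown f ⊗ g) N       ≡⟨ cong₂ _+_ (ℤP.*-comm (f 0) _) (go (shiftDown f) g N) ⟩
    g (suc N) * f 0 + (g ⊗ shiftDown f) N       ≡⟨ ℤP.+-comm (g (suc N) * f 0) _ ⟩
    (g ⊗ shiftDown f) N + g (suc N) * f 0       ≡⟨ ⊗-sucʳ g f N ⟨
    (g ⊗ f) (suc N)                            ∎
    where open ≡-Reasoning

⊗-zeroˡ : ∀ g → 0ps ⊗ g ≋ 0ps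
⊗-zeroˡ g = coeffwise λ N → sumTo-zero N _ (λ _ _ → refl)

⊗-identityˡ : ∀ g → one ⊗ g ≋ g
⊗-identityˡ g = coeffwise go
  where
  go : ∀ N → (one ⊗ g) N ≡ g N
  go zero    = ℤP.*-identityˡ (g 0)
  go (suc N) = begin
    (one ⊗ g) (suc N)                         ≡⟨ ⊗-suc one g N ⟩
    1ℤ * g (suc N) + (shiftDown one ⊗ g) N    ≡⟨ cong₂ _+_ (ℤP.*-identityˡ (g (suc N))) (coeff (⊗-zeroˡ g) N) ⟩
    g (suc N) + 0ℤ                            ≡⟨ ℤP.+-identityʳ (g (suc N)) ⟩
    g (suc N)                                 ∎
    where open ≡-Reasoning

⊗-distribˡ-⊕ : ∀ f g h → f ⊗ (g ⊕ h) ≋ (f ⊗ g) ⊕ (f ⊗ h)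
⊗-distribˡ-⊕ f g h = coeffwise λ N →
  trans (sumTo-cong N (λ i _ → ℤP.*-distribˡ-+ (f i) (g (N ∸ i)) (h (N ∸ i)))) (sumTo-+ N _ _)

⊗-distribʳ-⊕ : ∀ f g h → (g ⊕ h) ⊗ f ≋ (g ⊗ f) ⊕ (h ⊗ f)
⊗-distribʳ-⊕ f g h = coeffwise λ N →
  trans (sumTo-cong N (λ i _ → ℤP.*-distribʳ-+ (f (N ∸ i)) (g i) (h i))) (sumTo-+ N _ _)

scale-⊗ : ∀ c f g → scale c f ⊗ g ≋ scale c (f ⊗ g)
scale-⊗ c f g = coeffwise λ N →
  trans (sumTo-cong N (λ i _ → ℤP.*-assoc c (f i) (g (N ∸ i)))) (sym (sumTo-*ˡ N c _))

⊗-assoc : ∀ f g h → (f ⊗ g) ⊗ h ≋ f ⊗ (g ⊗ h)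
⊗-assoc f g h = coeffwise (go f g h)
  where
  go : ∀ f g h N → ((f ⊗ g) ⊗ h) N ≡ (f ⊗ (g ⊗ h)) N
  go f g h zero    = ℤP.*-assoc (f 0) (g 0) (h 0)
  go f g h (suc N) = begin
    ((f ⊗ g) ⊗ h) (suc N)
      ≡⟨ ⊗-suc (f ⊗ g) h N ⟩
    (f 0 * g 0) * h (suc N) + (shiftDown (f ⊗ g) ⊗ h) N
      ≡⟨ cong₂ _+_ (ℤP.*-assoc (f 0) (g 0) _) (coeff (⊗-cong {g = h} (coeffwise (⊗-suc f g)) ≋-refl) N) ⟩
    f 0 * (g 0 * h (suc N)) + ((scale (f 0) (shiftDown g) ⊕ (shiftDown f ⊗ g)) ⊗ h) N
      ≡⟨ cong (f 0 * (g 0 * h (suc N)) +_) (coeff (⊗-distribʳ-⊕ h (scale (f 0) (shiftDown g)) (shiftDown f ⊗ g)) N) ⟩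
    f 0 * (g 0 * h (suc N)) + ((scale (f 0) (shiftDown g) ⊗ h) N + ((shiftDown f ⊗ g) ⊗ h) N)
      ≡⟨ cong (λ z → f 0 * (g 0 * h (suc N)) + z) (cong₂ _+_ (coeff (scale-⊗ (f 0) (shiftDown g) h) N) (go (shiftDown f) g h N)) ⟩
    f 0 * (g 0 * h (suc N)) + (f 0 * (shiftDown g ⊗ h) N + (shiftDown f ⊗ (g ⊗ h)) N)
      ≡⟨ ℤP.+-assoc (f 0 * (g 0 * h (suc N))) (f 0 * (shiftDown g ⊗ h) N) _ ⟨
    (f 0 * (g 0 * h (suc N)) + f 0 * (shiftDown g ⊗ h) N) + (shiftDown f ⊗ (g ⊗ h)) N
      ≡⟨ cong (_+ (shiftDown f ⊗ (g ⊗ h)) N) (ℤP.*-distribˡ-+ (f 0) (g 0 * h (suc N)) _) ⟨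
    f 0 * (g 0 * h (suc N) + (shiftDown g ⊗ h) N) + (shiftDown f ⊗ (g ⊗ h)) N
      ≡⟨ cong (λ z → f 0 * z + (shiftDown f ⊗ (g ⊗ h)) N) (⊗-suc g h N) ⟨
    f 0 * (g ⊗ h) (suc N) + (shiftDown f ⊗ (g ⊗ h)) N
      ≡⟨ ⊗-suc f (g ⊗ h) N ⟨
    (f ⊗ (g ⊗ h)) (suc N) ∎
    where open ≡-Reasoning

PS-commutativeRing : CommutativeRing _ _
PS-commutativeRing = record
  { Carrier = PS ; _≈_ = _≋_ ; _+_ = _⊕_ ; _*_ = _⊗_ ; -_ = neg ; 0# = 0ps ; 1# = one
  ; isCommutativeRing = record
    { isRing = record
      { +-isAbelianGroup = record
        { isGroup = record
          { isMonoid = record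
            { isSemigroup = record
              { isMagma = record
                { isEquivalence = record { refl = ≋-refl ; sym = ≋-sym ; trans = ≋-trans }
                ; ∙-cong = ⊕-cong }
              ; assoc = λ f g h → coeffwise λ N → ℤP.+-assoc (f N) (g N) (h N) }
            ; identity = (λ f → coeffwise λ N → ℤP.+-identityˡ (f N))
                       , (λ f → coeffwise λ N → ℤP.+-identityʳ (f N)) }
          ; inverse = (λ f → coeffwise λ N → ℤP.+-inverseˡ (f N))
                    , (λ f → coeffwise λ N → ℤP.+-inverseʳ (f N))
          ; ⁻¹-cong = neg-cong }
        ; comm = λ f g → coeffwise λ N → ℤP.+-comm (f N) (g N) }
      ; *-cong = ⊗-cong
      ; *-assoc = ⊗-assoc
      ; *-identity = ⊗-identityˡ , (λ f → ≋-trans (⊗-comm f one) (⊗-identityˡ f))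
      ; distrib = ⊗-distribˡ-⊕ , ⊗-distribʳ-⊕ }
    ; *-comm = ⊗-comm }
  }

module PS = CommutativeRing PS-commutativeRing
module ≋-Reasoning = Relation.Binary.Reasoning.Setoid PS.setoid

scale-neg : ∀ c f → scale (- c) f ≋ scale c (neg f)
scale-neg c f = coeffwise λ N → trans (sym (ℤP.neg-distribˡ-* c (f N))) (ℤP.neg-distribʳ-* c (f N))

scale-cong : ∀ c {f g} → f ≋ g → scale c f ≋ scale c g
scale-cong c f≋g = coeffwise λ N → cong (c *_) (coeff f≋g N)

-- Integer constants are interpreted with 0 and 1 sent to 0ps and one on the nose, so that the
-- ring solver produces terms that match hand-written ones definitionally.
const : ℤ → PS
const (ℤ.+ zero)       = 0ps
const (ℤ.+ (suc zero)) = one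
const c                = scale c one

const≋scale : ∀ c → const c ≋ scale c one
const≋scale (ℤ.+ zero)          = coeffwise λ _ → refl
const≋scale (ℤ.+ (suc zero))    = coeffwise λ N → sym (ℤP.*-identityˡ (one N))
const≋scale (ℤ.+ (suc (suc n))) = ≋-refl
const≋scale (ℤ.-[1+ n ])        = ≋-refl

scale≋scale-one-⊗ : ∀ c f → scale c f ≋ scale c one ⊗ f
scale≋scale-one-⊗ c f = ≋-sym (≋-trans (scale-⊗ c one f) (scale-cong c (⊗-identityˡ f)))

const-homo : CommutativeRing.rawRing ℤP.+-*-commutativeRing ACR.-Raw-AlmostCommutative⟶ ACR.fromCommutativeRing PS-commutativeRing
const-homo = record
  { ⟦_⟧    = const
  ; +-homo = λ a b → coeffwise λ N → begin
      const (a + b) N          ≡⟨ coeff (const≋scale (a + b)) N ⟩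
      (a + b) * one N          ≡⟨ ℤP.*-distribʳ-+ (one N) a b ⟩
      a * one N + b * one N    ≡⟨ cong₂ _+_ (coeff (const≋scale a) N) (coeff (const≋scale b) N) ⟨
      const a N + const b N    ∎
  ; *-homo = λ a b → ≋-trans (const≋scale (a * b)) (≋-trans
      (coeffwise λ N → trans (ℤP.*-assoc a b (one N)) (cong (a *_) (sym (coeff (const≋scale b) N))))
      (≋-trans (scale≋scale-one-⊗ a (const b)) (⊗-cong {g = const b} (≋-sym (const≋scale a)) ≋-refl)))
  ; -‿homo = λ a → coeffwise λ N → begin
      const (- a) N            ≡⟨ coeff (const≋scale (- a)) N ⟩
      - a * one N              ≡⟨ ℤP.neg-distribˡ-* a (one N) ⟨
      - (a * one N)            ≡⟨ cong -_ (coeff (const≋scale a) N) ⟨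
      - const a N              ∎
  ; 0-homo = ≋-refl
  ; 1-homo = ≋-refl
  }
  where open ≡-Reasoning

const-≟ : WeaklyDecidable (ACR.Induced-equivalence const-homo)
const-≟ a b with a ℤ.≟ b
... | yes refl = just ≋-refl
... | no _     = nothing

module PS-Solver = Algebra.Solver.Ring _ _ const-homo const-≟
open PS-Solver using (solve; _:=_; _:+_; _:*_; :-_; _:-_; con)

module ⊗-Solver = Algebra.Solver.CommutativeMonoid PS.*-commutativeMonoid
open ⊗-Solver using (_⊜_) renaming (solve to rearrange; _⊕_ to _∙_; id to ε)

≡⇒≋ : ∀ {f g} → f ≡ g → f ≋ g
≡⇒≋ refl = ≋-refl

⊗-congˡ : ∀ {f f′} g → f ≋ f′ → f ⊗ g ≋ f′ ⊗ g
⊗-congˡ g f≋f′ = ⊗-cong f≋f′ (≋-refl {g})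

⊗-congʳ : ∀ f {g g′} → g ≋ g′ → f ⊗ g ≋ f ⊗ g′
⊗-congʳ f g≋g′ = ⊗-cong (≋-refl {f}) g≋g′

⊕-congˡ : ∀ {f f′} g → f ≋ f′ → f ⊕ g ≋ f′ ⊕ g
⊕-congˡ g f≋f′ = ⊕-cong f≋f′ (≋-refl {g})

⊕-congʳ : ∀ f {g g′} → g ≋ g′ → f ⊕ g ≋ f ⊕ g′
⊕-congʳ f g≋g′ = ⊕-cong (≋-refl {f}) g≋g′

⊖-cong : ∀ {f f′ g g′} → f ≋ f′ → g ≋ g′ → f ⊖ g ≋ f′ ⊖ g′
⊖-cong f≋f′ g≋g′ = ⊕-cong f≋f′ (neg-cong g≋g′)

⊖-congʳ : ∀ f {g g′} → g ≋ g′ → f ⊖ g ≋ f ⊖ g′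
⊖-congʳ f g≋g′ = ⊕-congʳ f (neg-cong g≋g′)

⊗-identityʳ : ∀ f → f ⊗ one ≋ f
⊗-identityʳ f = ≋-trans (⊗-comm f one) (⊗-identityˡ f)

-- Congruences modulo powers of q

infix 4 _≈[_]_
record _≈[_]_ (f : PS) (M : ℕ) (g : PS) : Set where
  constructor upTo
  field coeff≤ : ∀ N → N ≤ M → f N ≡ g N
open _≈[_]_ public

module _ {M : ℕ} where

  ≈-refl : ∀ {f} → f ≈[ M ] f
  ≈-refl = upTo λ _ _ → refl

  ≈-sym : ∀ {f g} → f ≈[ M ] g → g ≈[ M ] f
  ≈-sym p = upTo λ N N≤M → sym (coeff≤ p N N≤M)

  ≈-trans : ∀ {f g h} → f ≈[ M ] g → g ≈[ M ] h → f ≈[ M ] h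
  ≈-trans p q = upTo λ N N≤M → trans (coeff≤ p N N≤M) (coeff≤ q N N≤M)

  ≋⇒≈ : ∀ {f g} → f ≋ g → f ≈[ M ] g
  ≋⇒≈ p = upTo λ N _ → coeff p N

  ⊗-cong-≈ : ∀ {f f′ g g′} → f ≈[ M ] f′ → g ≈[ M ] g′ → f ⊗ g ≈[ M ] f′ ⊗ g′
  ⊗-cong-≈ f≈f′ g≈g′ = upTo λ N N≤M → sumTo-cong N λ i i≤N →
    cong₂ _*_ (coeff≤ f≈f′ i (ℕP.≤-trans i≤N N≤M)) (coeff≤ g≈g′ (N ∸ i) (ℕP.≤-trans (ℕP.m∸n≤m N i) N≤M))

  ⊕-cong-≈ : ∀ {f f′ g g′} → f ≈[ M ] f′ → g ≈[ M ] g′ → f ⊕ g ≈[ M ] f′ ⊕ g′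
  ⊕-cong-≈ f≈f′ g≈g′ = upTo λ N N≤M → cong₂ _+_ (coeff≤ f≈f′ N N≤M) (coeff≤ g≈g′ N N≤M)

  ⊖-cong-≈ : ∀ {f f′ g g′} → f ≈[ M ] f′ → g ≈[ M ] g′ → f ⊖ g ≈[ M ] f′ ⊖ g′
  ⊖-cong-≈ f≈f′ g≈g′ = ⊕-cong-≈ f≈f′ (upTo λ N N≤M → cong -_ (coeff≤ g≈g′ N N≤M))

≈-weaken : ∀ {M M′ f g} → M′ ≤ M → f ≈[ M ] g → f ≈[ M′ ] g
≈-weaken M′≤M p = upTo λ N N≤M′ → coeff≤ p N (ℕP.≤-trans N≤M′ M′≤M)

≈⇒≋ : ∀ {f g} → (∀ M → f ≈[ M ] g) → f ≋ g
≈⇒≋ p = coeffwise λ N → coeff≤ (p N) N ℕP.≤-refl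

≈-setoid : ℕ → Setoid _ _
≈-setoid M = record
  { Carrier = PS ; _≈_ = _≈[ M ]_
  ; isEquivalence = record { refl = ≈-refl ; sym = ≈-sym ; trans = ≈-trans } }

module ≈-Reasoning (M : ℕ) = Relation.Binary.Reasoning.Setoid (≈-setoid M)

⊗-cancelˡ-≈ : ∀ f {g h} M → f 0 ≡ 1ℤ → f ⊗ g ≈[ M ] f ⊗ h → g ≈[ M ] h
⊗-cancelˡ-≈ f {g} {h} M f0≡1 = go M
  where
  unit : ∀ x → f 0 * x ≡ x
  unit x = trans (cong (_* x) f0≡1) (ℤP.*-identityˡ x)
  go : ∀ M → f ⊗ g ≈[ M ] f ⊗ h → g ≈[ M ] h
  go zero    fg≈fh = upTo λ { zero _ → trans (sym (unit (g 0))) (trans (coeff≤ fg≈fh 0 z≤n) (unit (h 0))) }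
  go (suc M) fg≈fh = upTo λ N N≤M+1 → case N (ℕP.m≤n⇒m<n∨m≡n N≤M+1)
    where
    g≈h : g ≈[ M ] h
    g≈h = go M (≈-weaken (ℕP.n≤1+n M) fg≈fh)
    top : g (suc M) ≡ h (suc M)
    top = begin
      g (suc M)                                  ≡⟨ unit (g (suc M)) ⟨
      f 0 * g (suc M)                            ≡⟨ ∙-cancelʳ ((shiftDown f ⊗ g) M) _ _ (begin
        f 0 * g (suc M) + (shiftDown f ⊗ g) M      ≡⟨ ⊗-suc f g M ⟨
        (f ⊗ g) (suc M)                            ≡⟨ coeff≤ fg≈fh (suc M) ℕP.≤-refl ⟩
        (f ⊗ h) (suc M)                            ≡⟨ ⊗-suc f h M ⟩
        f 0 * h (suc M) + (shiftDown f ⊗ h) M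
          ≡⟨ cong (f 0 * h (suc M) +_) (coeff≤ (⊗-cong-≈ {f = shiftDown f} ≈-refl g≈h) M ℕP.≤-refl) ⟨
        f 0 * h (suc M) + (shiftDown f ⊗ g) M      ∎) ⟩
      f 0 * h (suc M)                            ≡⟨ unit (h (suc M)) ⟩
      h (suc M)                                  ∎
      where open ≡-Reasoning
    case : ∀ N → N < suc M ⊎ N ≡ suc M → g N ≡ h N
    case N (inj₁ N<M+1) = coeff≤ g≈h N (ℕP.≤-pred N<M+1)
    case N (inj₂ refl)  = top

infix 4 q^_∣_
record q^_∣_ (k : ℕ) (f : PS) : Set where
  constructor vanishing
  field coeff< : ∀ N → N < k → f N ≡ 0ℤ
open q^_∣_ public

∣⇒≈0 : ∀ {M f} → q^ suc M ∣ f → f ≈[ M ] 0ps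
∣⇒≈0 q∣f = upTo λ N N≤M → coeff< q∣f N (s≤s N≤M)

∣-weaken : ∀ {k k′ f} → k′ ≤ k → q^ k ∣ f → q^ k′ ∣ f
∣-weaken k′≤k q∣f = vanishing λ N N<k′ → coeff< q∣f N (ℕP.<-≤-trans N<k′ k′≤k)

∣-⊕ : ∀ {k f g} → q^ k ∣ f → q^ k ∣ g → q^ k ∣ f ⊕ g
∣-⊕ q∣f q∣g = vanishing λ N N<k → cong₂ _+_ (coeff< q∣f N N<k) (coeff< q∣g N N<k)

∣-scale : ∀ {k f} c → q^ k ∣ f → q^ k ∣ scale c f
∣-scale c q∣f = vanishing λ N N<k → trans (cong (c *_) (coeff< q∣f N N<k)) (ℤP.*-zeroʳ c)

∣⇒∣⊗ʳ : ∀ {k f} g → q^ k ∣ f → q^ k ∣ f ⊗ g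
∣⇒∣⊗ʳ g q∣f = vanishing λ N N<k → sumTo-zero N _ λ i i≤N →
  cong (_* g (N ∸ i)) (coeff< q∣f i (ℕP.≤-<-trans i≤N N<k))

∣⇒∣⊗ˡ : ∀ f {k g} → q^ k ∣ g → q^ k ∣ f ⊗ g
∣⇒∣⊗ˡ f {g = g} q∣g = vanishing λ N N<k → trans (coeff (⊗-comm f g) N) (coeff< (∣⇒∣⊗ʳ f q∣g) N N<k)

shiftUp : PS → PS
shiftUp f zero    = 0ℤ
shiftUp f (suc N) = f N

q^k∣qpow : ∀ k → q^ k ∣ qpow k
q^k∣qpow k = vanishing (go k)
  where
  go : ∀ k N → N < k → qpow k N ≡ 0ℤ
  go (suc k) zero    _         = refl
  go (suc k) (suc N) (s≤s N<k) = go k N N<k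

qpow-suc : ∀ a → qpow (suc a) ≋ shiftUp (qpow a)
qpow-suc a = coeffwise λ { zero → refl ; (suc N) → refl }

shiftUp-cong : ∀ {f g} → f ≋ g → shiftUp f ≋ shiftUp g
shiftUp-cong f≋g = coeffwise λ { zero → refl ; (suc N) → coeff f≋g N }

shiftUp-⊗ : ∀ f g → shiftUp f ⊗ g ≋ shiftUp (f ⊗ g)
shiftUp-⊗ f g = coeffwise λ
  { zero    → refl
  ; (suc N) → trans (⊗-suc (shiftUp f) g N) (ℤP.+-identityˡ ((f ⊗ g) N)) }

qpow-+ : ∀ a b → qpow a ⊗ qpow b ≋ qpow (a ℕ.+ b)
qpow-+ zero    b = ⊗-identityˡ (qpow b)
qpow-+ (suc a) b = begin
  qpow (suc a) ⊗ qpow b       ≈⟨ ⊗-congˡ (qpow b) (qpow-suc a) ⟩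
  shiftUp (qpow a) ⊗ qpow b   ≈⟨ shiftUp-⊗ (qpow a) (qpow b) ⟩
  shiftUp (qpow a ⊗ qpow b)   ≈⟨ shiftUp-cong (qpow-+ a b) ⟩
  shiftUp (qpow (a ℕ.+ b))    ≈⟨ qpow-suc (a ℕ.+ b) ⟨
  qpow (suc a ℕ.+ b)          ∎
  where open ≋-Reasoning

qpow-⊗-coeff : ∀ d g N → (qpow d ⊗ g) (d ℕ.+ N) ≡ g N
qpow-⊗-coeff zero    g N = coeff (⊗-identityˡ g) N
qpow-⊗-coeff (suc d) g N = begin
  (qpow (suc d) ⊗ g) (suc d ℕ.+ N)      ≡⟨ coeff (⊗-congˡ g (qpow-suc d)) (suc d ℕ.+ N) ⟩
  (shiftUp (qpow d) ⊗ g) (suc d ℕ.+ N)  ≡⟨ coeff (shiftUp-⊗ (qpow d) g) (suc d ℕ.+ N) ⟩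
  (qpow d ⊗ g) (d ℕ.+ N)                ≡⟨ qpow-⊗-coeff d g N ⟩
  g N                                   ∎
  where open ≡-Reasoning

qpow-⊗-cancel : ∀ d {f g} → qpow d ⊗ f ≋ qpow d ⊗ g → f ≋ g
qpow-⊗-cancel d {f} {g} p = coeffwise λ N →
  trans (sym (qpow-⊗-coeff d f N)) (trans (coeff p (d ℕ.+ N)) (qpow-⊗-coeff d g N))

Σ≤ : ℕ → (ℕ → PS) → PS
Σ≤ K F N = sumTo K (λ n → F n N)

Σ≤-cong : ∀ K {F G} → (∀ n → n ≤ K → F n ≋ G n) → Σ≤ K F ≋ Σ≤ K G
Σ≤-cong K F≋G = coeffwise λ N → sumTo-cong K λ n n≤K → coeff (F≋G n n≤K) N

Σ≤-cong-≈ : ∀ K {M F G} → (∀ n → n ≤ K → F n ≈[ M ] G n) → Σ≤ K F ≈[ M ] Σ≤ K G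
Σ≤-cong-≈ K F≈G = upTo λ N N≤M → sumTo-cong K λ n n≤K → coeff≤ (F≈G n n≤K) N N≤M

Σ≤-suc : ∀ K F → Σ≤ (suc K) F ≋ F 0 ⊕ Σ≤ K (F ∘ suc)
Σ≤-suc K F = coeffwise λ N → sumTo-suc K (λ n → F n N)

Σ≤-⊕ : ∀ K F G → Σ≤ K (λ n → F n ⊕ G n) ≋ Σ≤ K F ⊕ Σ≤ K G
Σ≤-⊕ K F G = coeffwise λ N → sumTo-+ K (λ n → F n N) (λ n → G n N)

⊗-Σ≤ : ∀ K g F → g ⊗ Σ≤ K F ≋ Σ≤ K (λ n → g ⊗ F n)
⊗-Σ≤ zero    g F = ≋-refl
⊗-Σ≤ (suc K) g F = ≋-trans (⊗-distribˡ-⊕ g (Σ≤ K F) (F (suc K))) (⊕-congˡ (g ⊗ F (suc K)) (⊗-Σ≤ K g F))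

Σ≤-telescope : ∀ K (R : ℕ → PS) → Σ≤ K (λ n → R n ⊖ R (suc n)) ≋ R 0 ⊖ R (suc K)
Σ≤-telescope zero    R = ≋-refl
Σ≤-telescope (suc K) R = ≋-trans (⊕-congˡ (R (suc K) ⊖ R (suc (suc K))) (Σ≤-telescope K R))
  (solve 3 (λ a b c → (a :- b) :+ (b :- c) := a :- c) PS.refl (R 0) (R (suc K)) (R (suc (suc K))))

Σ≤-drop-last : ∀ K F → F (suc K) ≋ 0ps → Σ≤ (suc K) F ≋ Σ≤ K F
Σ≤-drop-last K F Fsuc≋0 = ≋-trans (⊕-congʳ (Σ≤ K F) Fsuc≋0) (PS.+-identityʳ (Σ≤ K F))

Σ≤-≈-head : ∀ K {M} F → (∀ n → F (suc n) ≈[ M ] 0ps) → Σ≤ K F ≈[ M ] F 0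
Σ≤-≈-head zero    F tail≈0 = ≈-refl
Σ≤-≈-head (suc K) F tail≈0 =
  ≈-trans (⊕-cong-≈ (Σ≤-≈-head K F tail≈0) (tail≈0 K)) (≋⇒≈ (PS.+-identityʳ (F 0)))

LocallyFinite : (ℕ → PS) → Set
LocallyFinite F = ∀ n → q^ n ∣ F n

lsum-≈-Σ≤ : ∀ {F} → LocallyFinite F → ∀ {M} K → M ≤ K → lsum F ≈[ M ] Σ≤ K F
lsum-≈-Σ≤ {F} finite K M≤K = upTo λ N N≤M → begin
  sumTo N (λ n → F n N)
    ≡⟨ sumTo-pad N (K ∸ N) (λ n → F n N) (λ n N<n → coeff< (finite n) N N<n) ⟨
  sumTo (N ℕ.+ (K ∸ N)) (λ n → F n N)
    ≡⟨ cong (λ k → sumTo k (λ n → F n N)) (ℕP.m+[n∸m]≡n (ℕP.≤-trans N≤M M≤K)) ⟩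
  sumTo K (λ n → F n N) ∎
  where open ≡-Reasoning

lsum-cong : ∀ {F G} → (∀ n → F n ≋ G n) → lsum F ≋ lsum G
lsum-cong F≋G = coeffwise λ N → sumTo-cong N λ n _ → coeff (F≋G n) N

-- q-Pochhammer symbols

infix 21 1-q^_
1-q^_ : ℕ → PS
1-q^ e = one ⊖ qpow e

∏< : ℕ → (ℕ → PS) → PS
∏< zero    F = one
∏< (suc k) F = ∏< k F ⊗ F k

∏<-cong : ∀ k {F G} → (∀ i → F i ≋ G i) → ∏< k F ≋ ∏< k G
∏<-cong zero    F≋G = ≋-refl
∏<-cong (suc k) F≋G = ⊗-cong (∏<-cong k F≋G) (F≋G k)

∏<-⊗ : ∀ k F G → ∏< k (λ i → F i ⊗ G i) ≋ ∏< k F ⊗ ∏< k G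
∏<-⊗ zero    F G = ≋-sym (⊗-identityˡ one)
∏<-⊗ (suc k) F G = ≋-trans (⊗-congˡ (F k ⊗ G k) (∏<-⊗ k F G))
  (rearrange 4 (λ p q f g → (p ∙ q) ∙ (f ∙ g) ⊜ (p ∙ f) ∙ (q ∙ g)) PS.refl (∏< k F) (∏< k G) (F k) (G k))

poch : ℕ → ℕ → ℕ → PS
poch s b k = ∏< k (λ i → 1-q^ (s ℕ.+ b ℕ.* i))

poch-+ : ∀ s b k k′ → poch s b (k ℕ.+ k′) ≋ poch s b k ⊗ poch (s ℕ.+ b ℕ.* k) b k′
poch-+ s b k zero = ≋-trans (≡⇒≋ (cong (poch s b) (ℕP.+-identityʳ k))) (≋-sym (⊗-identityʳ (poch s b k)))
poch-+ s b k (suc k′) = begin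
  poch s b (k ℕ.+ suc k′)
    ≈⟨ ≡⇒≋ (cong (poch s b) (ℕP.+-suc k k′)) ⟩
  poch s b (k ℕ.+ k′) ⊗ 1-q^ (s ℕ.+ b ℕ.* (k ℕ.+ k′))
    ≈⟨ ⊗-cong (poch-+ s b k k′) (≡⇒≋ (cong 1-q^_ exponent)) ⟩
  (poch s b k ⊗ poch (s ℕ.+ b ℕ.* k) b k′) ⊗ 1-q^ ((s ℕ.+ b ℕ.* k) ℕ.+ b ℕ.* k′)
    ≈⟨ ⊗-assoc (poch s b k) (poch (s ℕ.+ b ℕ.* k) b k′) (1-q^ ((s ℕ.+ b ℕ.* k) ℕ.+ b ℕ.* k′)) ⟩
  poch s b k ⊗ poch (s ℕ.+ b ℕ.* k) b (suc k′) ∎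
  where
  open ≋-Reasoning
  exponent : s ℕ.+ b ℕ.* (k ℕ.+ k′) ≡ (s ℕ.+ b ℕ.* k) ℕ.+ b ℕ.* k′
  exponent = trans (cong (s ℕ.+_) (ℕP.*-distribˡ-+ b k k′)) (sym (ℕP.+-assoc s (b ℕ.* k) (b ℕ.* k′)))

poch-dissect : ∀ s b k n → poch s b (n ℕ.* k) ≋ ∏< k (λ i → poch (s ℕ.+ b ℕ.* i) (k ℕ.* b) n)
poch-dissect s b k zero    = ≋-sym (ones k)
  where
  ones : ∀ k → ∏< k (λ _ → one) ≋ one
  ones zero    = ≋-refl
  ones (suc k) = ≋-trans (⊗-identityʳ (∏< k (λ _ → one))) (ones k)
poch-dissect s b k (suc n) = begin
  poch s b (k ℕ.+ n ℕ.* k)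
    ≈⟨ ≋-trans (≡⇒≋ (cong (poch s b) (ℕP.+-comm k (n ℕ.* k)))) (poch-+ s b (n ℕ.* k) k) ⟩
  poch s b (n ℕ.* k) ⊗ ∏< k (λ i → 1-q^ ((s ℕ.+ b ℕ.* (n ℕ.* k)) ℕ.+ b ℕ.* i))
    ≈⟨ ⊗-cong (poch-dissect s b k n) (∏<-cong k λ i → ≡⇒≋ (cong 1-q^_ (exponent s b k n i))) ⟩
  ∏< k (λ i → poch (s ℕ.+ b ℕ.* i) (k ℕ.* b) n) ⊗ ∏< k (λ i → 1-q^ ((s ℕ.+ b ℕ.* i) ℕ.+ (k ℕ.* b) ℕ.* n))
    ≈⟨ ∏<-⊗ k (λ i → poch (s ℕ.+ b ℕ.* i) (k ℕ.* b) n) (λ i → 1-q^ ((s ℕ.+ b ℕ.* i) ℕ.+ (k ℕ.* b) ℕ.* n)) ⟨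
  ∏< k (λ i → poch (s ℕ.+ b ℕ.* i) (k ℕ.* b) (suc n)) ∎
  where
  open ≋-Reasoning
  exponent : ∀ s b k n i → (s ℕ.+ b ℕ.* (n ℕ.* k)) ℕ.+ b ℕ.* i ≡ (s ℕ.+ b ℕ.* i) ℕ.+ (k ℕ.* b) ℕ.* n
  exponent = solve-∀

poch-sucˡ : ∀ s b k → poch s b (suc k) ≋ 1-q^ s ⊗ poch (s ℕ.+ b) b k
poch-sucˡ s b k = begin
  poch s b (suc k)                                ≈⟨ poch-+ s b 1 k ⟩
  (one ⊗ 1-q^ (s ℕ.+ b ℕ.* 0)) ⊗ poch (s ℕ.+ b ℕ.* 1) b k
    ≈⟨ ⊗-cong (⊗-identityˡ (1-q^ (s ℕ.+ b ℕ.* 0))) (≡⇒≋ (cong (λ x → poch (s ℕ.+ x) b k) (ℕP.*-identityʳ b))) ⟩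
  1-q^ (s ℕ.+ b ℕ.* 0) ⊗ poch (s ℕ.+ b) b k
    ≈⟨ ⊗-congˡ (poch (s ℕ.+ b) b k) (≡⇒≋ (cong 1-q^_ (trans (cong (s ℕ.+_) (ℕP.*-zeroʳ b)) (ℕP.+-identityʳ s)))) ⟩
  1-q^ s ⊗ poch (s ℕ.+ b) b k                     ∎
  where open ≋-Reasoning

1-q^-≈1 : ∀ {M e} → M < e → 1-q^ e ≈[ M ] one
1-q^-≈1 M<e = upTo λ N N≤M →
  trans (cong (λ z → one N + - z) (coeff≤ (∣⇒≈0 (∣-weaken M<e (q^k∣qpow _))) N N≤M)) (ℤP.+-identityʳ (one N))

poch-≈1 : ∀ {M} s b k → M < s → poch s b k ≈[ M ] one
poch-≈1 s b zero    M<s = ≈-refl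
poch-≈1 s b (suc k) M<s = ≈-trans
  (⊗-cong-≈ (poch-≈1 s b k M<s) (1-q^-≈1 (ℕP.<-≤-trans M<s (ℕP.m≤m+n s (b ℕ.* k)))))
  (≋⇒≈ (⊗-identityˡ one))

poch-+-≈ : ∀ {M} s b k d → M < s ℕ.+ b ℕ.* k → poch s b (k ℕ.+ d) ≈[ M ] poch s b k
poch-+-≈ s b k d M<s+bk = ≈-trans (≋⇒≈ (poch-+ s b k d))
  (≈-trans (⊗-cong-≈ {f = poch s b k} ≈-refl (poch-≈1 (s ℕ.+ b ℕ.* k) b d M<s+bk)) (≋⇒≈ (⊗-identityʳ (poch s b k))))

M≤k⇒M<s+b*k : ∀ {M} s b k → 1 ≤ s → 1 ≤ b → M ≤ k → M < s ℕ.+ b ℕ.* k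
M≤k⇒M<s+b*k s b k 1≤s 1≤b M≤k = ℕP.<-≤-trans (s≤s (ℕP.≤-trans M≤k (ℕP.m≤n*m k b ⦃ ℕ.>-nonZero 1≤b ⦄))) (ℕP.+-monoˡ-≤ (b ℕ.* k) 1≤s)

poch-stable : ∀ {M} s b k k′ → 1 ≤ s → 1 ≤ b → M ≤ k → M ≤ k′ → poch s b k ≈[ M ] poch s b k′
poch-stable s b k k′ 1≤s 1≤b M≤k M≤k′ with ℕP.≤-total k k′
... | inj₁ k≤k′ = ≈-sym (≈-trans (≋⇒≈ (≡⇒≋ (cong (poch s b) (sym (ℕP.m+[n∸m]≡n k≤k′)))))
                                  (poch-+-≈ s b k (k′ ∸ k) (M≤k⇒M<s+b*k s b k 1≤s 1≤b M≤k)))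
... | inj₂ k′≤k = ≈-trans (≋⇒≈ (≡⇒≋ (cong (poch s b) (sym (ℕP.m+[n∸m]≡n k′≤k)))))
                          (poch-+-≈ s b k′ (k ∸ k′) (M≤k⇒M<s+b*k s b k′ 1≤s 1≤b M≤k′))

-- (q^s; q)_∞, whose coefficient of q^N is already that of the partial product of length N + 1
poch∞ : ℕ → PS
poch∞ s N = poch s 1 (suc N) N

poch∞-≈ : ∀ {M} s K → 1 ≤ s → M ≤ K → poch∞ s ≈[ M ] poch s 1 K
poch∞-≈ s K 1≤s M≤K = upTo λ N N≤M →
  coeff≤ (poch-stable s 1 (suc N) K 1≤s ℕP.≤-refl (ℕP.n≤1+n N) (ℕP.≤-trans N≤M M≤K)) N ℕP.≤-refl

poch∞-sucˡ : ∀ s → 1 ≤ s → poch∞ s ≋ 1-q^ s ⊗ poch∞ (suc s)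
poch∞-sucˡ s 1≤s = coeffwise coeffs
  where
  open ≡-Reasoning
  tail : ∀ N → poch (s ℕ.+ 1) 1 N ≈[ N ] poch∞ (suc s)
  tail N = ≈-trans (≋⇒≈ (≡⇒≋ (cong (λ x → poch x 1 N) (ℕP.+-comm s 1))))
                   (≈-sym (poch∞-≈ (suc s) N (s≤s z≤n) ℕP.≤-refl))
  coeffs : ∀ N → poch∞ s N ≡ (1-q^ s ⊗ poch∞ (suc s)) N
  coeffs N = begin
    poch∞ s N                         ≡⟨ coeff≤ (poch∞-≈ s (suc N) 1≤s (ℕP.n≤1+n N)) N ℕP.≤-refl ⟩
    poch s 1 (suc N) N                ≡⟨ coeff (poch-sucˡ s 1 N) N ⟩
    (1-q^ s ⊗ poch (s ℕ.+ 1) 1 N) N   ≡⟨ coeff≤ (⊗-cong-≈ {f = 1-q^ s} ≈-refl (tail N)) N ℕP.≤-refl ⟩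
    (1-q^ s ⊗ poch∞ (suc s)) N        ∎

1-q^-inverse : ∀ j → 1-q^ suc j ⊗ invOneMinusQpow j ≋ one
1-q^-inverse j = ≋-trans (⊗-distribʳ-⊕ g one (neg (qpow (suc j))))
                         (≋-trans (⊕-cong (⊗-identityˡ g) (neg-⊗ (qpow (suc j)))) (coeffwise coeffs))
  where
  g : PS
  g = invOneMinusQpow j
  neg-⊗ : ∀ f → neg f ⊗ g ≋ neg (f ⊗ g)
  neg-⊗ f = solve 2 (λ f g → (:- f) :* g := :- (f :* g)) PS.refl f g
  periodic : ∀ M → g (suc j ℕ.+ M) ≡ g M
  periodic M = cong (λ r → if r ℕ.≡ᵇ 0 then 1ℤ else 0ℤ)
    (trans (cong (ℕ._% suc j) (ℕP.+-comm (suc j) M)) (ℕD.[m+n]%n≡m%n M (suc j)))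
  initial : ∀ N → N < suc j → g N ≡ one N
  initial zero    _   = refl
  initial (suc N) N<j rewrite ℕD.m<n⇒m%n≡m N<j = refl
  coeffs : ∀ N → g N + - (qpow (suc j) ⊗ g) N ≡ one N
  coeffs N with N ℕ.<? suc j
  ... | yes N<j = begin
    g N + - (qpow (suc j) ⊗ g) N ≡⟨ cong (λ z → g N + - z) (coeff< (∣⇒∣⊗ʳ g (q^k∣qpow (suc j))) N N<j) ⟩
    g N + 0ℤ                     ≡⟨ ℤP.+-identityʳ (g N) ⟩
    g N                          ≡⟨ initial N N<j ⟩
    one N                        ∎
    where open ≡-Reasoning
  ... | no N≮j = begin
    g N + - (qpow (suc j) ⊗ g) N                ≡⟨ cong (λ n → g n + - (qpow (suc j) ⊗ g) n) N≡ ⟨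
    g (suc j ℕ.+ M) + - (qpow (suc j) ⊗ g) (suc j ℕ.+ M)
      ≡⟨ cong₂ (λ x y → x + - y) (periodic M) (qpow-⊗-coeff (suc j) g M) ⟩
    g M + - g M                                 ≡⟨ ℤP.+-inverseʳ (g M) ⟩
    one (suc j ℕ.+ M)                           ≡⟨ cong one N≡ ⟩
    one N                                       ∎
    where
    open ≡-Reasoning
    M : ℕ
    M = N ∸ suc j
    N≡ : suc j ℕ.+ M ≡ N
    N≡ = ℕP.m+[n∸m]≡n (ℕP.≮⇒≥ N≮j)

invQPoch-inverse : ∀ n → invQPoch n ⊗ poch 1 1 n ≋ one
invQPoch-inverse zero    = ⊗-identityˡ one
invQPoch-inverse (suc n) = begin
  (invQPoch n ⊗ invOneMinusQpow n) ⊗ (poch 1 1 n ⊗ 1-q^ (1 ℕ.+ 1 ℕ.* n))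
    ≈⟨ ⊗-congʳ (invQPoch n ⊗ invOneMinusQpow n) (⊗-congʳ (poch 1 1 n) (≡⇒≋ (cong (λ k → 1-q^ suc k) (ℕP.*-identityˡ n)))) ⟩
  (invQPoch n ⊗ invOneMinusQpow n) ⊗ (poch 1 1 n ⊗ 1-q^ suc n)
    ≈⟨ solve 4 (λ a j p e → (a :* j) :* (p :* e) := (a :* p) :* (e :* j)) PS.refl
             (invQPoch n) (invOneMinusQpow n) (poch 1 1 n) (1-q^ suc n) ⟩
  (invQPoch n ⊗ poch 1 1 n) ⊗ (1-q^ suc n ⊗ invOneMinusQpow n)
    ≈⟨ ⊗-cong (invQPoch-inverse n) (1-q^-inverse n) ⟩
  one ⊗ one
    ≈⟨ ⊗-identityˡ one ⟩
  one ∎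
  where open ≋-Reasoning

-- Gaussian binomial coefficients

module GaussianBinomial (b : ℕ) where

  infix 21 z^_
  z^_ : ℕ → PS
  z^ k = qpow (b ℕ.* k)

  gauss : ℕ → ℕ → PS
  gauss zero    zero    = one
  gauss zero    (suc k) = 0ps
  gauss (suc N) zero    = one
  gauss (suc N) (suc k) = gauss N k ⊕ (z^ suc k ⊗ gauss N (suc k))

  gauss-zero : ∀ N → gauss N 0 ≋ one
  gauss-zero zero    = ≋-refl
  gauss-zero (suc N) = ≋-refl

  gauss-vanish : ∀ N k → N < k → gauss N k ≋ 0ps
  gauss-vanish zero    (suc k) _         = ≋-refl
  gauss-vanish (suc N) (suc k) (s≤s N<k) = begin
    gauss N k ⊕ (z^ suc k ⊗ gauss N (suc k))
      ≈⟨ ⊕-cong (gauss-vanish N k N<k) (⊗-congʳ (z^ suc k) (gauss-vanish N (suc k) (ℕP.m<n⇒m<1+n N<k))) ⟩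
    0ps ⊕ (z^ suc k ⊗ 0ps)
      ≈⟨ solve 1 (λ w → con 0ℤ :+ w :* con 0ℤ := con 0ℤ) PS.refl (z^ suc k) ⟩
    0ps ∎
    where open ≋-Reasoning

  z^-+ : ∀ i j → z^ i ⊗ z^ j ≋ z^ (i ℕ.+ j)
  z^-+ i j = ≋-trans (qpow-+ (b ℕ.* i) (b ℕ.* j)) (≡⇒≋ (cong qpow (sym (ℕP.*-distribˡ-+ b i j))))

  z^-suc : ∀ k → z^ suc k ≋ z^ 1 ⊗ z^ k
  z^-suc k = ≋-sym (z^-+ 1 k)

  z^-zero : z^ 0 ≋ one
  z^-zero = ≡⇒≋ (cong qpow (ℕP.*-zeroʳ b))

  gauss-suc : ∀ N k → gauss (suc N) (suc k) ≋ gauss N k ⊕ ((z^ 1 ⊗ z^ k) ⊗ gauss N (suc k))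
  gauss-suc N k = ⊕-congʳ (gauss N k) (⊗-congˡ (gauss N (suc k)) (z^-suc k))

  -- The q-analogues of (k+1) C(N+1,k+1) = (N+1) C(N,k) and (k+1) C(N,k+1) = (N-k) C(N,k),
  -- proved by simultaneous induction on N; the second supplies the cancellation needed in the first.
  mutual
    gauss-absorption : ∀ N k →
      (one ⊖ (z^ 1 ⊗ z^ k)) ⊗ gauss (suc N) (suc k) ≋ (one ⊖ (z^ 1 ⊗ z^ N)) ⊗ gauss N k
    gauss-absorption zero zero =
      solve 2 (λ z w → (con 1ℤ :- z :* w) :* (con 1ℤ :+ z :* con 0ℤ) := (con 1ℤ :- z :* w) :* con 1ℤ)
        PS.refl (z^ 1) (z^ 0)
    gauss-absorption zero (suc k) =
      solve 4 (λ z w v u → (con 1ℤ :- z :* w) :* (con 0ℤ :+ v :* con 0ℤ) := (con 1ℤ :- z :* u) :* con 0ℤ)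
        PS.refl (z^ 1) (z^ suc k) (z^ suc (suc k)) (z^ 0)
    gauss-absorption (suc N) zero = begin
      (one ⊖ (z ⊗ z^ 0)) ⊗ (one ⊕ (z ⊗ gauss (suc N) 1))
        ≈⟨ solve 3 (λ z u v → (con 1ℤ :- z :* u) :* (con 1ℤ :+ z :* v) := (con 1ℤ :- z :* u) :+ z :* ((con 1ℤ :- z :* u) :* v))
                 PS.refl z (z^ 0) (gauss (suc N) 1) ⟩
      (one ⊖ (z ⊗ z^ 0)) ⊕ (z ⊗ ((one ⊖ (z ⊗ z^ 0)) ⊗ gauss (suc N) 1))
        ≈⟨ ⊕-cong (⊖-congʳ one (⊗-congʳ z z^-zero))
                  (⊗-congʳ z (≋-trans (gauss-absorption N 0) (⊗-congʳ (one ⊖ (z ⊗ z^ N)) (gauss-zero N)))) ⟩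
      (one ⊖ (z ⊗ one)) ⊕ (z ⊗ ((one ⊖ (z ⊗ z^ N)) ⊗ one))
        ≈⟨ solve 2 (λ z n → (con 1ℤ :- z :* con 1ℤ) :+ z :* ((con 1ℤ :- z :* n) :* con 1ℤ) := (con 1ℤ :- z :* (z :* n)) :* con 1ℤ)
                 PS.refl z (z^ N) ⟩
      (one ⊖ (z ⊗ (z ⊗ z^ N))) ⊗ one
        ≈⟨ ⊗-congˡ one (⊖-congʳ one (⊗-congʳ z (≋-sym (z^-suc N)))) ⟩
      (one ⊖ (z ⊗ z^ suc N)) ⊗ one ∎
      where
      open ≋-Reasoning
      z : PS
      z = z^ 1
    gauss-absorption (suc N) (suc k) = begin
      (one ⊖ (z ⊗ z^ suc k)) ⊗ (gauss (suc N) (suc k) ⊕ (z^ suc (suc k) ⊗ V))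
        ≈⟨ ⊗-cong (⊖-congʳ one (⊗-congʳ z (z^-suc k)))
                  (⊕-cong (gauss-suc N k) (⊗-congˡ V (≋-trans (z^-suc (suc k)) (⊗-congʳ z (z^-suc k))))) ⟩
      (one ⊖ z²w) ⊗ ((X ⊕ (zw ⊗ Y)) ⊕ (z²w ⊗ V))
        ≈⟨ solve 5 (λ z w x y v → (con 1ℤ :- z :* (z :* w)) :* ((x :+ (z :* w) :* y) :+ (z :* (z :* w)) :* v)
                   := (con 1ℤ :- z :* (z :* w)) :* (x :+ (z :* w) :* y) :+ (z :* (z :* w)) :* ((con 1ℤ :- z :* (z :* w)) :* v))
                 PS.refl z w X Y V ⟩
      ((one ⊖ z²w) ⊗ (X ⊕ (zw ⊗ Y))) ⊕ (z²w ⊗ ((one ⊖ z²w) ⊗ V))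
        ≈⟨ ⊕-congʳ ((one ⊖ z²w) ⊗ (X ⊕ (zw ⊗ Y)))
                   (⊗-congʳ z²w (≋-trans (⊗-congˡ V (⊖-congʳ one (⊗-congʳ z (≋-sym (z^-suc k))))) (gauss-absorption N (suc k)))) ⟩
      ((one ⊖ z²w) ⊗ (X ⊕ (zw ⊗ Y))) ⊕ (z²w ⊗ ((one ⊖ (z ⊗ n)) ⊗ Y))
        ≈⟨ solve 5 (λ z w x y n → (con 1ℤ :- z :* (z :* w)) :* (x :+ (z :* w) :* y) :+ (z :* (z :* w)) :* ((con 1ℤ :- z :* n) :* y)
                   := ((con 1ℤ :- z :* (z :* n)) :* (x :+ (z :* w) :* y) :+ (z :* z) :* (w :* ((con 1ℤ :- z :* w) :* y))) :- (z :* z) :* ((w :- n) :* x))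
                 PS.refl z w X Y n ⟩
      (((one ⊖ z²n) ⊗ (X ⊕ (zw ⊗ Y))) ⊕ ((z ⊗ z) ⊗ (w ⊗ ((one ⊖ zw) ⊗ Y)))) ⊖ ((z ⊗ z) ⊗ ((w ⊖ n) ⊗ X))
        ≈⟨ ⊕-congˡ (neg ((z ⊗ z) ⊗ ((w ⊖ n) ⊗ X))) (⊕-congʳ ((one ⊖ z²n) ⊗ (X ⊕ (zw ⊗ Y))) (⊗-congʳ (z ⊗ z) (gauss-ratio N k))) ⟩
      (((one ⊖ z²n) ⊗ (X ⊕ (zw ⊗ Y))) ⊕ ((z ⊗ z) ⊗ ((w ⊖ n) ⊗ X))) ⊖ ((z ⊗ z) ⊗ ((w ⊖ n) ⊗ X))
        ≈⟨ solve 2 (λ u v → (u :+ v) :- v := u) PS.refl ((one ⊖ z²n) ⊗ (X ⊕ (zw ⊗ Y))) ((z ⊗ z) ⊗ ((w ⊖ n) ⊗ X)) ⟩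
      (one ⊖ z²n) ⊗ (X ⊕ (zw ⊗ Y))
        ≈⟨ ⊗-cong (⊖-congʳ one (⊗-congʳ z (≋-sym (z^-suc N)))) (≋-sym (gauss-suc N k)) ⟩
      (one ⊖ (z ⊗ z^ suc N)) ⊗ gauss (suc N) (suc k) ∎
      where
      open ≋-Reasoning
      z w n zw z²w z²n X Y V : PS
      z = z^ 1
      w = z^ k
      n = z^ N
      zw = z ⊗ w
      z²w = z ⊗ (z ⊗ w)
      z²n = z ⊗ (z ⊗ n)
      X = gauss N k
      Y = gauss N (suc k)
      V = gauss (suc N) (suc (suc k))

    gauss-ratio : ∀ N k → z^ k ⊗ ((one ⊖ (z^ 1 ⊗ z^ k)) ⊗ gauss N (suc k)) ≋ (z^ k ⊖ z^ N) ⊗ gauss N k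
    gauss-ratio zero zero =
      solve 2 (λ u z → u :* ((con 1ℤ :- z :* u) :* con 0ℤ) := (u :- u) :* con 1ℤ) PS.refl (z^ 0) (z^ 1)
    gauss-ratio zero (suc k) =
      solve 3 (λ w z u → w :* ((con 1ℤ :- z :* w) :* con 0ℤ) := (w :- u) :* con 0ℤ) PS.refl (z^ suc k) (z^ 1) (z^ 0)
    gauss-ratio (suc N) zero = begin
      z^ 0 ⊗ ((one ⊖ (z ⊗ z^ 0)) ⊗ gauss (suc N) 1)
        ≈⟨ ⊗-cong z^-zero (≋-trans (gauss-absorption N 0) (⊗-congʳ (one ⊖ (z ⊗ z^ N)) (gauss-zero N))) ⟩
      one ⊗ ((one ⊖ (z ⊗ z^ N)) ⊗ one)
        ≈⟨ solve 2 (λ z n → con 1ℤ :* ((con 1ℤ :- z :* n) :* con 1ℤ) := (con 1ℤ :- z :* n) :* con 1ℤ) PS.refl z (z^ N) ⟩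
      (one ⊖ (z ⊗ z^ N)) ⊗ one
        ≈⟨ ⊗-congˡ one (⊖-cong (≋-sym z^-zero) (≋-sym (z^-suc N))) ⟩
      (z^ 0 ⊖ z^ suc N) ⊗ one ∎
      where
      open ≋-Reasoning
      z : PS
      z = z^ 1
    gauss-ratio (suc N) (suc k) = begin
      z^ suc k ⊗ ((one ⊖ (z ⊗ z^ suc k)) ⊗ gauss (suc N) (suc (suc k)))
        ≈⟨ ⊗-cong (z^-suc k) (gauss-absorption N (suc k)) ⟩
      zw ⊗ ((one ⊖ (z ⊗ n)) ⊗ Y)
        ≈⟨ solve 5 (λ z w n y x → (z :* w) :* ((con 1ℤ :- z :* n) :* y)
                   := ((z :* w :- z :* n) :* (x :+ (z :* w) :* y) :+ z :* (w :* ((con 1ℤ :- z :* w) :* y))) :- z :* ((w :- n) :* x))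
                 PS.refl z w n Y X ⟩
      (((zw ⊖ (z ⊗ n)) ⊗ (X ⊕ (zw ⊗ Y))) ⊕ (z ⊗ (w ⊗ ((one ⊖ zw) ⊗ Y)))) ⊖ (z ⊗ ((w ⊖ n) ⊗ X))
        ≈⟨ ⊕-congˡ (neg (z ⊗ ((w ⊖ n) ⊗ X))) (⊕-congʳ ((zw ⊖ (z ⊗ n)) ⊗ (X ⊕ (zw ⊗ Y))) (⊗-congʳ z (gauss-ratio N k))) ⟩
      (((zw ⊖ (z ⊗ n)) ⊗ (X ⊕ (zw ⊗ Y))) ⊕ (z ⊗ ((w ⊖ n) ⊗ X))) ⊖ (z ⊗ ((w ⊖ n) ⊗ X))
        ≈⟨ solve 2 (λ u v → (u :+ v) :- v := u) PS.refl ((zw ⊖ (z ⊗ n)) ⊗ (X ⊕ (zw ⊗ Y))) (z ⊗ ((w ⊖ n) ⊗ X)) ⟩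
      (zw ⊖ (z ⊗ n)) ⊗ (X ⊕ (zw ⊗ Y))
        ≈⟨ ⊗-cong (⊖-cong (≋-sym (z^-suc k)) (≋-sym (z^-suc N))) (≋-sym (gauss-suc N k)) ⟩
      (z^ suc k ⊖ z^ suc N) ⊗ gauss (suc N) (suc k) ∎
      where
      open ≋-Reasoning
      z w n zw X Y : PS
      z = z^ 1
      w = z^ k
      n = z^ N
      zw = z ⊗ w
      X = gauss N k
      Y = gauss N (suc k)

  gauss-pascal′ : ∀ N k → k ≤ N → gauss (suc N) (suc k) ≋ (z^ (N ∸ k) ⊗ gauss N k) ⊕ gauss N (suc k)
  gauss-pascal′ N k k≤N =
    subst (λ M → gauss (suc M) (suc k) ≋ (z^ (N ∸ k) ⊗ gauss M k) ⊕ gauss M (suc k))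
          (ℕP.m+[n∸m]≡n k≤N) (pascal′ (N ∸ k))
    where
    pascal′ : ∀ d → gauss (suc (k ℕ.+ d)) (suc k) ≋ (z^ d ⊗ gauss (k ℕ.+ d) k) ⊕ gauss (k ℕ.+ d) (suc k)
    pascal′ d = qpow-⊗-cancel (b ℕ.* k) (begin
      w ⊗ gauss (suc (k ℕ.+ d)) (suc k)
        ≈⟨ ⊗-congʳ w (gauss-suc (k ℕ.+ d) k) ⟩
      w ⊗ (X ⊕ ((z ⊗ w) ⊗ Y))
        ≈⟨ solve 5 (λ w x z y u → w :* (x :+ (z :* w) :* y)
                   := (w :* ((u :* x) :+ y)) :+ (((w :* x) :- ((w :* u) :* x)) :- (w :* ((con 1ℤ :- z :* w) :* y))))
                 PS.refl w X z Y u ⟩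
      (w ⊗ ((u ⊗ X) ⊕ Y)) ⊕ (((w ⊗ X) ⊖ ((w ⊗ u) ⊗ X)) ⊖ (w ⊗ ((one ⊖ (z ⊗ w)) ⊗ Y)))
        ≈⟨ ⊕-congʳ (w ⊗ ((u ⊗ X) ⊕ Y)) (⊖-congʳ ((w ⊗ X) ⊖ ((w ⊗ u) ⊗ X))
             (≋-trans (gauss-ratio (k ℕ.+ d) k) (⊗-congˡ X (⊖-congʳ w (≋-sym (z^-+ k d)))))) ⟩
      (w ⊗ ((u ⊗ X) ⊕ Y)) ⊕ (((w ⊗ X) ⊖ ((w ⊗ u) ⊗ X)) ⊖ ((w ⊖ (w ⊗ u)) ⊗ X))
        ≈⟨ solve 4 (λ w x y u → (w :* ((u :* x) :+ y)) :+ (((w :* x) :- ((w :* u) :* x)) :- ((w :- (w :* u)) :* x))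
                   := w :* ((u :* x) :+ y))
                 PS.refl w X Y u ⟩
      w ⊗ ((u ⊗ X) ⊕ Y) ∎)
      where
      open ≋-Reasoning
      z w u X Y : PS
      z = z^ 1
      w = z^ k
      u = z^ d
      X = gauss (k ℕ.+ d) k
      Y = gauss (k ℕ.+ d) (suc k)

  poch-⊗-gauss : ∀ k N → poch b b k ⊗ gauss (k ℕ.+ N) k ≋ poch (b ℕ.* suc N) b k
  poch-⊗-gauss zero    N = ≋-trans (⊗-identityˡ (gauss N 0)) (gauss-zero N)
  poch-⊗-gauss (suc k) N = begin
    (Z ⊗ 1-q^ (b ℕ.+ b ℕ.* k)) ⊗ gauss (suc (k ℕ.+ N)) (suc k)
      ≈⟨ ⊗-assoc Z (1-q^ (b ℕ.+ b ℕ.* k)) (gauss (suc (k ℕ.+ N)) (suc k)) ⟩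
    Z ⊗ (1-q^ (b ℕ.+ b ℕ.* k) ⊗ gauss (suc (k ℕ.+ N)) (suc k))
      ≈⟨ ⊗-congʳ Z (⊗-congˡ (gauss (suc (k ℕ.+ N)) (suc k))
           (⊖-congʳ one (≋-trans (≡⇒≋ (cong qpow (sym (ℕP.*-suc b k)))) (z^-suc k)))) ⟩
    Z ⊗ ((one ⊖ (z^ 1 ⊗ z^ k)) ⊗ gauss (suc (k ℕ.+ N)) (suc k))
      ≈⟨ ⊗-congʳ Z (gauss-absorption (k ℕ.+ N) k) ⟩
    Z ⊗ (O ⊗ gauss (k ℕ.+ N) k)
      ≈⟨ solve 3 (λ p o x → p :* (o :* x) := (p :* x) :* o) PS.refl Z O (gauss (k ℕ.+ N) k) ⟩
    (Z ⊗ gauss (k ℕ.+ N) k) ⊗ O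
      ≈⟨ ⊗-cong (poch-⊗-gauss k N) (⊖-congʳ one (≋-trans (≋-sym (z^-suc (k ℕ.+ N))) (≡⇒≋ (cong qpow exponent)))) ⟩
    poch (b ℕ.* suc N) b k ⊗ 1-q^ (b ℕ.* suc N ℕ.+ b ℕ.* k) ∎
    where
    open ≋-Reasoning
    Z = poch b b k
    O : PS
    O = one ⊖ (z^ 1 ⊗ z^ (k ℕ.+ N))
    exponent : b ℕ.* suc (k ℕ.+ N) ≡ b ℕ.* suc N ℕ.+ b ℕ.* k
    exponent = trans (cong (b ℕ.*_) (trans (sym (ℕP.+-suc k N)) (ℕP.+-comm k (suc N)))) (ℕP.*-distribˡ-+ b (suc N) k)

  poch-⊗-gauss-≈1 : ∀ k N {M} → 1 ≤ b → M ≤ N → poch b b k ⊗ gauss (k ℕ.+ N) k ≈[ M ] one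
  poch-⊗-gauss-≈1 k N 1≤b M≤N = ≈-trans (≋⇒≈ (poch-⊗-gauss k N))
    (poch-≈1 (b ℕ.* suc N) b k (ℕP.<-≤-trans (s≤s M≤N) (ℕP.m≤n*m (suc N) b ⦃ ℕ.>-nonZero 1≤b ⦄)))

sgn-suc-suc : ∀ n → sgn (suc (suc n)) ≡ sgn n
sgn-suc-suc n = ℤP.neg-involutive (sgn n)

sgn-double-+ : ∀ n k → sgn ((n ℕ.+ n) ℕ.+ k) ≡ sgn k
sgn-double-+ zero    k = refl
sgn-double-+ (suc n) k =
  trans (cong (λ m → sgn (suc m ℕ.+ k)) (ℕP.+-suc n n)) (trans (sgn-suc-suc ((n ℕ.+ n) ℕ.+ k)) (sgn-double-+ n k))

scale-qpow-⊗-qpow : ∀ s x y → scale s (qpow x) ⊗ qpow y ≋ scale s (qpow (x ℕ.+ y))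
scale-qpow-⊗-qpow s x y = ≋-trans (scale-⊗ s (qpow x) (qpow y)) (scale-cong s (qpow-+ x y))

neg-qpow-⊗-scale-qpow : ∀ s x y → neg (qpow y) ⊗ scale s (qpow x) ≋ scale (- s) (qpow (x ℕ.+ y))
neg-qpow-⊗-scale-qpow s x y = begin
  neg (qpow y) ⊗ scale s (qpow x)      ≈⟨ ⊗-comm (neg (qpow y)) (scale s (qpow x)) ⟩
  scale s (qpow x) ⊗ neg (qpow y)      ≈⟨ scale-⊗ s (qpow x) (neg (qpow y)) ⟩
  scale s (qpow x ⊗ neg (qpow y))
    ≈⟨ scale-cong s (≋-trans (solve 2 (λ u v → u :* (:- v) := :- (u :* v)) PS.refl (qpow x) (qpow y)) (neg-cong (qpow-+ x y))) ⟩
  scale s (neg (qpow (x ℕ.+ y)))       ≈⟨ coeffwise (λ N → ℤP.neg-distribʳ-* s (qpow (x ℕ.+ y) N)) ⟨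
  neg (scale s (qpow (x ℕ.+ y)))       ≈⟨ coeffwise (λ N → ℤP.neg-distribˡ-* s (qpow (x ℕ.+ y) N)) ⟩
  scale (- s) (qpow (x ℕ.+ y))         ∎
  where open ≋-Reasoning

-- tri n = n (n - 1) / 2
tri : ℕ → ℕ
tri zero    = 0
tri (suc n) = tri n ℕ.+ n

tri-*2 : ∀ k → tri k ℕ.* 2 ℕ.+ k ≡ k ℕ.* k
tri-*2 zero    = refl
tri-*2 (suc k) = begin
  (tri k ℕ.+ k) ℕ.* 2 ℕ.+ suc k         ≡⟨ regroup (tri k) k ⟩
  (tri k ℕ.* 2 ℕ.+ k) ℕ.+ (k ℕ.+ suc k) ≡⟨ cong (ℕ._+ (k ℕ.+ suc k)) (tri-*2 k) ⟩
  k ℕ.* k ℕ.+ (k ℕ.+ suc k)             ≡⟨ square k ⟩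
  suc k ℕ.* suc k                       ∎
  where
  open ≡-Reasoning
  regroup : ∀ t k → (t ℕ.+ k) ℕ.* 2 ℕ.+ suc k ≡ (t ℕ.* 2 ℕ.+ k) ℕ.+ (k ℕ.+ suc k)
  regroup = solve-∀
  square : ∀ k → k ℕ.* k ℕ.+ (k ℕ.+ suc k) ≡ suc k ℕ.* suc k
  square = solve-∀

-- The Jacobi triple product

module JacobiTripleProduct (a c : ℕ) where

  b : ℕ
  b = a ℕ.+ c

  open GaussianBinomial b

  -- The bilateral index k = j - m is encoded by the pair (m, j); jacobiExp m j = b k(k-1)/2 + a k.
  jacobiExp : ℕ → ℕ → ℕ
  jacobiExp zero    j       = b ℕ.* tri j ℕ.+ a ℕ.* j
  jacobiExp (suc m) zero    = b ℕ.* tri (suc m) ℕ.+ c ℕ.* suc m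
  jacobiExp (suc m) (suc j) = jacobiExp m j

  jacobiExp-sucˡ : ∀ m j → jacobiExp (suc m) j ℕ.+ b ℕ.* j ≡ jacobiExp m j ℕ.+ (c ℕ.+ b ℕ.* m)
  jacobiExp-sucˡ zero    zero    = identity a c
    where
    identity : ∀ a c → ((a ℕ.+ c) ℕ.* 0 ℕ.+ c ℕ.* 1) ℕ.+ (a ℕ.+ c) ℕ.* 0
                     ≡ ((a ℕ.+ c) ℕ.* 0 ℕ.+ a ℕ.* 0) ℕ.+ (c ℕ.+ (a ℕ.+ c) ℕ.* 0)
    identity = solve-∀
  jacobiExp-sucˡ (suc m) zero    = identity a c (tri m) m
    where
    identity : ∀ a c t m → ((a ℕ.+ c) ℕ.* ((t ℕ.+ m) ℕ.+ suc m) ℕ.+ c ℕ.* suc (suc m)) ℕ.+ (a ℕ.+ c) ℕ.* 0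
                         ≡ ((a ℕ.+ c) ℕ.* (t ℕ.+ m) ℕ.+ c ℕ.* suc m) ℕ.+ (c ℕ.+ (a ℕ.+ c) ℕ.* suc m)
    identity = solve-∀
  jacobiExp-sucˡ zero    (suc j) = identity a c (tri j) j
    where
    identity : ∀ a c t j → ((a ℕ.+ c) ℕ.* t ℕ.+ a ℕ.* j) ℕ.+ (a ℕ.+ c) ℕ.* suc j
                         ≡ ((a ℕ.+ c) ℕ.* (t ℕ.+ j) ℕ.+ a ℕ.* suc j) ℕ.+ (c ℕ.+ (a ℕ.+ c) ℕ.* 0)
    identity = solve-∀
  jacobiExp-sucˡ (suc m) (suc j) = begin
    jacobiExp (suc m) j ℕ.+ b ℕ.* suc j          ≡⟨ peel a c (jacobiExp (suc m) j) j ⟩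
    (jacobiExp (suc m) j ℕ.+ b ℕ.* j) ℕ.+ b      ≡⟨ cong (ℕ._+ b) (jacobiExp-sucˡ m j) ⟩
    (jacobiExp m j ℕ.+ (c ℕ.+ b ℕ.* m)) ℕ.+ b    ≡⟨ absorb a c (jacobiExp m j) m ⟩
    jacobiExp m j ℕ.+ (c ℕ.+ b ℕ.* suc m)        ∎
    where
    open ≡-Reasoning
    peel : ∀ a c x j → x ℕ.+ (a ℕ.+ c) ℕ.* suc j ≡ (x ℕ.+ (a ℕ.+ c) ℕ.* j) ℕ.+ (a ℕ.+ c)
    peel = solve-∀
    absorb : ∀ a c y m → (y ℕ.+ (c ℕ.+ (a ℕ.+ c) ℕ.* m)) ℕ.+ (a ℕ.+ c) ≡ y ℕ.+ (c ℕ.+ (a ℕ.+ c) ℕ.* suc m)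
    absorb = solve-∀

  jacobiExp-sucʳ : ∀ m i d d′ → i ℕ.+ d ≡ m ℕ.+ d′ →
                   jacobiExp m (suc i) ℕ.+ b ℕ.* d ≡ jacobiExp m i ℕ.+ (a ℕ.+ b ℕ.* d′)
  jacobiExp-sucʳ m i d d′ i+d≡m+d′ = ℕP.+-cancelʳ-≡ (c ℕ.+ b ℕ.* m) _ _ (begin
    (X ℕ.+ b ℕ.* d) ℕ.+ (c ℕ.+ b ℕ.* m)   ≡⟨ swap a c X d m ⟩
    (X ℕ.+ (c ℕ.+ b ℕ.* m)) ℕ.+ b ℕ.* d   ≡⟨ cong (ℕ._+ b ℕ.* d) (jacobiExp-sucˡ m (suc i)) ⟨
    (Y ℕ.+ b ℕ.* suc i) ℕ.+ b ℕ.* d       ≡⟨ collect a c Y i d ⟩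
    (Y ℕ.+ b) ℕ.+ b ℕ.* (i ℕ.+ d)         ≡⟨ cong (λ n → (Y ℕ.+ b) ℕ.+ b ℕ.* n) i+d≡m+d′ ⟩
    (Y ℕ.+ b) ℕ.+ b ℕ.* (m ℕ.+ d′)        ≡⟨ split a c Y m d′ ⟩
    (Y ℕ.+ (a ℕ.+ b ℕ.* d′)) ℕ.+ (c ℕ.+ b ℕ.* m) ∎)
    where
    open ≡-Reasoning
    X Y : ℕ
    X = jacobiExp m (suc i)
    Y = jacobiExp m i
    swap : ∀ a c x d m → (x ℕ.+ (a ℕ.+ c) ℕ.* d) ℕ.+ (c ℕ.+ (a ℕ.+ c) ℕ.* m)
                       ≡ (x ℕ.+ (c ℕ.+ (a ℕ.+ c) ℕ.* m)) ℕ.+ (a ℕ.+ c) ℕ.* d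
    swap = solve-∀
    collect : ∀ a c y i d → (y ℕ.+ (a ℕ.+ c) ℕ.* suc i) ℕ.+ (a ℕ.+ c) ℕ.* d
                          ≡ (y ℕ.+ (a ℕ.+ c)) ℕ.+ (a ℕ.+ c) ℕ.* (i ℕ.+ d)
    collect = solve-∀
    split : ∀ a c y m d → (y ℕ.+ (a ℕ.+ c)) ℕ.+ (a ℕ.+ c) ℕ.* (m ℕ.+ d)
                        ≡ (y ℕ.+ (a ℕ.+ (a ℕ.+ c) ℕ.* d)) ℕ.+ (c ℕ.+ (a ℕ.+ c) ℕ.* m)
    split = solve-∀

  jacobiExp-zero : jacobiExp 0 0 ≡ 0
  jacobiExp-zero = identity a c
    where
    identity : ∀ a c → (a ℕ.+ c) ℕ.* 0 ℕ.+ a ℕ.* 0 ≡ 0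
    identity = solve-∀

  jacobiExp-diagonal : ∀ m k → jacobiExp m (m ℕ.+ k) ≡ jacobiExp 0 k
  jacobiExp-diagonal zero    k = refl
  jacobiExp-diagonal (suc m) k = jacobiExp-diagonal m k

  jacobiExp-≥-right : 1 ≤ a → ∀ m j → j ∸ m ≤ jacobiExp m j
  jacobiExp-≥-right 1≤a zero    j       = ℕP.≤-trans (ℕP.m≤n*m j a ⦃ ℕ.>-nonZero 1≤a ⦄) (ℕP.m≤n+m (a ℕ.* j) (b ℕ.* tri j))
  jacobiExp-≥-right 1≤a (suc m) zero    = z≤n
  jacobiExp-≥-right 1≤a (suc m) (suc j) = jacobiExp-≥-right 1≤a m j

  jacobiExp-≥-left : 1 ≤ c → ∀ m j → m ∸ j ≤ jacobiExp m j
  jacobiExp-≥-left 1≤c zero    j       = subst (_≤ jacobiExp 0 j) (sym (ℕP.0∸n≡0 j)) z≤n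
  jacobiExp-≥-left 1≤c (suc m) zero    =
    ℕP.≤-trans (ℕP.m≤n*m (suc m) c ⦃ ℕ.>-nonZero 1≤c ⦄) (ℕP.m≤n+m (c ℕ.* suc m) (b ℕ.* tri (suc m)))
  jacobiExp-≥-left 1≤c (suc m) (suc j) = jacobiExp-≥-left 1≤c m j

  jacobiTerm : ℕ → ℕ → PS
  jacobiTerm m j = scale (sgn (j ℕ.+ m)) (qpow (jacobiExp m j))

  jacobiTerm-zero : jacobiTerm 0 0 ≋ one
  jacobiTerm-zero = ≋-trans (≡⇒≋ (cong (λ e → scale 1ℤ (qpow e)) jacobiExp-zero)) (coeffwise λ N → ℤP.*-identityˡ (one N))

  jacobiTerm-suc-suc : ∀ m j → jacobiTerm (suc m) (suc j) ≋ jacobiTerm m j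
  jacobiTerm-suc-suc m j = ≡⇒≋ (cong (λ s → scale s (qpow (jacobiExp m j)))
    (trans (cong -_ (cong sgn (ℕP.+-suc j m))) (ℤP.neg-involutive (sgn (j ℕ.+ m)))))

  jacobiTerm-sucˡ-⊗ : ∀ m j → jacobiTerm (suc m) j ⊗ z^ j ≋ neg (qpow (c ℕ.+ b ℕ.* m)) ⊗ jacobiTerm m j
  jacobiTerm-sucˡ-⊗ m j = begin
    jacobiTerm (suc m) j ⊗ z^ j
      ≈⟨ scale-qpow-⊗-qpow (sgn (j ℕ.+ suc m)) (jacobiExp (suc m) j) (b ℕ.* j) ⟩
    scale (sgn (j ℕ.+ suc m)) (qpow (jacobiExp (suc m) j ℕ.+ b ℕ.* j))
      ≈⟨ ≡⇒≋ (cong₂ (λ s e → scale s (qpow e)) (cong sgn (ℕP.+-suc j m)) (jacobiExp-sucˡ m j)) ⟩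
    scale (- sgn (j ℕ.+ m)) (qpow (jacobiExp m j ℕ.+ (c ℕ.+ b ℕ.* m)))
      ≈⟨ neg-qpow-⊗-scale-qpow (sgn (j ℕ.+ m)) (jacobiExp m j) (c ℕ.+ b ℕ.* m) ⟨
    neg (qpow (c ℕ.+ b ℕ.* m)) ⊗ jacobiTerm m j ∎
    where open ≋-Reasoning

  jacobiTerm-sucʳ-⊗ : ∀ m i d d′ → i ℕ.+ d ≡ m ℕ.+ d′ →
                      jacobiTerm m (suc i) ⊗ z^ d ≋ neg (qpow (a ℕ.+ b ℕ.* d′)) ⊗ jacobiTerm m i
  jacobiTerm-sucʳ-⊗ m i d d′ i+d≡m+d′ = begin
    jacobiTerm m (suc i) ⊗ z^ d
      ≈⟨ scale-qpow-⊗-qpow (sgn (suc i ℕ.+ m)) (jacobiExp m (suc i)) (b ℕ.* d) ⟩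
    scale (sgn (suc i ℕ.+ m)) (qpow (jacobiExp m (suc i) ℕ.+ b ℕ.* d))
      ≈⟨ ≡⇒≋ (cong (λ e → scale (sgn (suc i ℕ.+ m)) (qpow e)) (jacobiExp-sucʳ m i d d′ i+d≡m+d′)) ⟩
    scale (- sgn (i ℕ.+ m)) (qpow (jacobiExp m i ℕ.+ (a ℕ.+ b ℕ.* d′)))
      ≈⟨ neg-qpow-⊗-scale-qpow (sgn (i ℕ.+ m)) (jacobiExp m i) (a ℕ.+ b ℕ.* d′) ⟨
    neg (qpow (a ℕ.+ b ℕ.* d′)) ⊗ jacobiTerm m i ∎
    where open ≋-Reasoning

  jacobiSum : ℕ → ℕ → PS
  jacobiSum N m = Σ≤ N (λ j → jacobiTerm m j ⊗ gauss N j)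

  private
    Σ≤-⊗-gauss-drop-last : ∀ N (X : ℕ → PS) → Σ≤ (suc N) (λ j → X j ⊗ gauss N j) ≋ Σ≤ N (λ j → X j ⊗ gauss N j)
    Σ≤-⊗-gauss-drop-last N X = Σ≤-drop-last N (λ j → X j ⊗ gauss N j)
      (≋-trans (⊗-congʳ (X (suc N)) (gauss-vanish N (suc N) ℕP.≤-refl)) (PS.zeroʳ (X (suc N))))

    ⊗-gauss-zero : ∀ N f → f ⊗ gauss N 0 ≋ f
    ⊗-gauss-zero N f = ≋-trans (⊗-congʳ f (gauss-zero N)) (⊗-identityʳ f)

    factor-1-q^ : ∀ N e (X : ℕ → PS) → Σ≤ N X ⊕ Σ≤ N (λ j → neg (qpow e) ⊗ X j) ≋ 1-q^ e ⊗ Σ≤ N X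
    factor-1-q^ N e X = ≋-trans (⊕-congʳ (Σ≤ N X) (≋-sym (⊗-Σ≤ N (neg (qpow e)) X)))
      (solve 2 (λ s x → s :+ (:- x) :* s := (con 1ℤ :- x) :* s) PS.refl (Σ≤ N X) (qpow e))

  jacobiSum-suc-suc : ∀ N m → jacobiSum (suc N) (suc m) ≋ 1-q^ (c ℕ.+ b ℕ.* m) ⊗ jacobiSum N m
  jacobiSum-suc-suc N m = begin
    Σ≤ (suc N) (λ j → U j ⊗ gauss (suc N) j)
      ≈⟨ ≋-trans (Σ≤-suc N (λ j → U j ⊗ gauss (suc N) j)) (⊕-cong (⊗-gauss-zero (suc N) (U 0)) (Σ≤-cong N λ i _ → pascal i)) ⟩
    U 0 ⊕ Σ≤ N (λ i → (V i ⊗ gauss N i) ⊕ W i)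
      ≈⟨ ⊕-congʳ (U 0) (Σ≤-⊕ N (λ i → V i ⊗ gauss N i) W) ⟩
    U 0 ⊕ (jacobiSum N m ⊕ Σ≤ N W)
      ≈⟨ solve 3 (λ u s w → u :+ (s :+ w) := s :+ (u :+ w)) PS.refl (U 0) (jacobiSum N m) (Σ≤ N W) ⟩
    jacobiSum N m ⊕ (U 0 ⊕ Σ≤ N W)
      ≈⟨ ⊕-congʳ (jacobiSum N m) (≋-trans (⊕-congˡ (Σ≤ N W) head) (≋-sym (Σ≤-suc N (λ j → (U j ⊗ z^ j) ⊗ gauss N j)))) ⟩
    jacobiSum N m ⊕ Σ≤ (suc N) (λ j → (U j ⊗ z^ j) ⊗ gauss N j)
      ≈⟨ ⊕-congʳ (jacobiSum N m) (≋-trans (Σ≤-⊗-gauss-drop-last N (λ j → U j ⊗ z^ j)) (Σ≤-cong N λ j _ → shift j)) ⟩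
    jacobiSum N m ⊕ Σ≤ N (λ j → neg (qpow e) ⊗ (V j ⊗ gauss N j))
      ≈⟨ factor-1-q^ N e (λ j → V j ⊗ gauss N j) ⟩
    1-q^ e ⊗ jacobiSum N m ∎
    where
    open ≋-Reasoning
    e : ℕ
    U V : ℕ → PS
    e = c ℕ.+ b ℕ.* m
    U = jacobiTerm (suc m)
    V = jacobiTerm m
    W : ℕ → PS
    W i = (U (suc i) ⊗ z^ suc i) ⊗ gauss N (suc i)
    pascal : ∀ i → U (suc i) ⊗ gauss (suc N) (suc i) ≋ (V i ⊗ gauss N i) ⊕ W i
    pascal i = ≋-trans (⊗-distribˡ-⊕ (U (suc i)) (gauss N i) (z^ suc i ⊗ gauss N (suc i)))
      (⊕-cong (⊗-congˡ (gauss N i) (jacobiTerm-suc-suc m i)) (≋-sym (⊗-assoc (U (suc i)) (z^ suc i) (gauss N (suc i)))))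
    head : U 0 ≋ (U 0 ⊗ z^ 0) ⊗ gauss N 0
    head = ≋-sym (≋-trans (⊗-gauss-zero N (U 0 ⊗ z^ 0)) (≋-trans (⊗-congʳ (U 0) z^-zero) (⊗-identityʳ (U 0))))
    shift : ∀ j → (U j ⊗ z^ j) ⊗ gauss N j ≋ neg (qpow e) ⊗ (V j ⊗ gauss N j)
    shift j = ≋-trans (⊗-congˡ (gauss N j) (jacobiTerm-sucˡ-⊗ m j)) (⊗-assoc (neg (qpow e)) (V j) (gauss N j))

  jacobiSum-suc : ∀ N m → m ≤ N → jacobiSum (suc N) m ≋ 1-q^ (a ℕ.+ b ℕ.* (N ∸ m)) ⊗ jacobiSum N m
  jacobiSum-suc N m m≤N = begin
    Σ≤ (suc N) (λ j → V j ⊗ gauss (suc N) j)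
      ≈⟨ ≋-trans (Σ≤-suc N (λ j → V j ⊗ gauss (suc N) j)) (⊕-cong (⊗-gauss-zero (suc N) (V 0)) (Σ≤-cong N pascal′)) ⟩
    V 0 ⊕ Σ≤ N (λ i → Z i ⊕ W i)
      ≈⟨ ⊕-congʳ (V 0) (Σ≤-⊕ N Z W) ⟩
    V 0 ⊕ (Σ≤ N Z ⊕ Σ≤ N W)
      ≈⟨ solve 3 (λ v z w → v :+ (z :+ w) := (v :+ w) :+ z) PS.refl (V 0) (Σ≤ N Z) (Σ≤ N W) ⟩
    (V 0 ⊕ Σ≤ N W) ⊕ Σ≤ N Z
      ≈⟨ ⊕-cong (≋-trans (⊕-congˡ (Σ≤ N W) (≋-sym (⊗-gauss-zero N (V 0)))) (≋-sym (Σ≤-suc N (λ j → V j ⊗ gauss N j))))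
                (Σ≤-cong N shift) ⟩
    Σ≤ (suc N) (λ j → V j ⊗ gauss N j) ⊕ Σ≤ N (λ i → neg (qpow e) ⊗ (V i ⊗ gauss N i))
      ≈⟨ ⊕-congˡ (Σ≤ N (λ i → neg (qpow e) ⊗ (V i ⊗ gauss N i))) (Σ≤-⊗-gauss-drop-last N V) ⟩
    jacobiSum N m ⊕ Σ≤ N (λ i → neg (qpow e) ⊗ (V i ⊗ gauss N i))
      ≈⟨ factor-1-q^ N e (λ j → V j ⊗ gauss N j) ⟩
    1-q^ e ⊗ jacobiSum N m ∎
    where
    open ≋-Reasoning
    e : ℕ
    V : ℕ → PS
    e = a ℕ.+ b ℕ.* (N ∸ m)
    V = jacobiTerm m
    Z W : ℕ → PS
    Z i = (V (suc i) ⊗ z^ (N ∸ i)) ⊗ gauss N i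
    W i = V (suc i) ⊗ gauss N (suc i)
    pascal′ : ∀ i → i ≤ N → V (suc i) ⊗ gauss (suc N) (suc i) ≋ Z i ⊕ W i
    pascal′ i i≤N = ≋-trans (⊗-congʳ (V (suc i)) (gauss-pascal′ N i i≤N))
      (≋-trans (⊗-distribˡ-⊕ (V (suc i)) (z^ (N ∸ i) ⊗ gauss N i) (gauss N (suc i)))
               (⊕-congˡ (W i) (≋-sym (⊗-assoc (V (suc i)) (z^ (N ∸ i)) (gauss N i)))))
    shift : ∀ i → i ≤ N → Z i ≋ neg (qpow e) ⊗ (V i ⊗ gauss N i)
    shift i i≤N = ≋-trans
      (⊗-congˡ (gauss N i) (jacobiTerm-sucʳ-⊗ m i (N ∸ i) (N ∸ m) (trans (ℕP.m+[n∸m]≡n i≤N) (sym (ℕP.m+[n∸m]≡n m≤N)))))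
      (⊗-assoc (neg (qpow e)) (V i) (gauss N i))

  finite-jacobi-triple-product : ∀ n → jacobiSum (n ℕ.+ n) n ≋ poch a b n ⊗ poch c b n
  finite-jacobi-triple-product zero    = ⊗-congˡ one jacobiTerm-zero
  finite-jacobi-triple-product (suc n) = begin
    jacobiSum (suc n ℕ.+ suc n) (suc n)
      ≈⟨ ≡⇒≋ (cong (λ N → jacobiSum N (suc n)) (cong suc (ℕP.+-suc n n))) ⟩
    jacobiSum (suc (suc (n ℕ.+ n))) (suc n)
      ≈⟨ jacobiSum-suc (suc (n ℕ.+ n)) (suc n) (s≤s (ℕP.m≤m+n n n)) ⟩
    1-q^ (a ℕ.+ b ℕ.* ((n ℕ.+ n) ∸ n)) ⊗ jacobiSum (suc (n ℕ.+ n)) (suc n)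
      ≈⟨ ⊗-cong (≡⇒≋ (cong (λ k → 1-q^ (a ℕ.+ b ℕ.* k)) (ℕP.m+n∸n≡m n n))) (jacobiSum-suc-suc (n ℕ.+ n) n) ⟩
    1-q^ (a ℕ.+ b ℕ.* n) ⊗ (1-q^ (c ℕ.+ b ℕ.* n) ⊗ jacobiSum (n ℕ.+ n) n)
      ≈⟨ ⊗-congʳ (1-q^ (a ℕ.+ b ℕ.* n)) (⊗-congʳ (1-q^ (c ℕ.+ b ℕ.* n)) (finite-jacobi-triple-product n)) ⟩
    1-q^ (a ℕ.+ b ℕ.* n) ⊗ (1-q^ (c ℕ.+ b ℕ.* n) ⊗ (poch a b n ⊗ poch c b n))
      ≈⟨ solve 4 (λ x y p q → x :* (y :* (p :* q)) := (p :* x) :* (q :* y)) PS.refl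
               (1-q^ (a ℕ.+ b ℕ.* n)) (1-q^ (c ℕ.+ b ℕ.* n)) (poch a b n) (poch c b n) ⟩
    poch a b (suc n) ⊗ poch c b (suc n) ∎
    where open ≋-Reasoning

  theta : ℕ → PS
  theta zero    = one
  theta (suc k) = scale (sgn (suc k)) (qpow (b ℕ.* tri (suc k) ℕ.+ a ℕ.* suc k) ⊕ qpow (b ℕ.* tri (suc k) ℕ.+ c ℕ.* suc k))

  -- The terms k and -k of the bilateral sum give theta k.
  Σ≤-jacobiTerm : ∀ n → Σ≤ (n ℕ.+ n) (jacobiTerm n) ≋ Σ≤ n theta
  Σ≤-jacobiTerm zero    = jacobiTerm-zero
  Σ≤-jacobiTerm (suc n) = begin
    Σ≤ (suc n ℕ.+ suc n) (jacobiTerm (suc n))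
      ≈⟨ ≡⇒≋ (cong (λ K → Σ≤ K (jacobiTerm (suc n))) (cong suc (ℕP.+-suc n n))) ⟩
    Σ≤ (suc (n ℕ.+ n)) (jacobiTerm (suc n)) ⊕ last
      ≈⟨ ⊕-congˡ last (Σ≤-suc (n ℕ.+ n) (jacobiTerm (suc n))) ⟩
    (first ⊕ Σ≤ (n ℕ.+ n) (λ j → jacobiTerm (suc n) (suc j))) ⊕ last
      ≈⟨ ⊕-congˡ last (⊕-congʳ first (≋-trans (Σ≤-cong (n ℕ.+ n) (λ j _ → jacobiTerm-suc-suc n j)) (Σ≤-jacobiTerm n))) ⟩
    (first ⊕ Σ≤ n theta) ⊕ last
      ≈⟨ solve 3 (λ x s l → (x :+ s) :+ l := s :+ (l :+ x)) PS.refl first (Σ≤ n theta) last ⟩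
    Σ≤ n theta ⊕ (last ⊕ first)
      ≈⟨ ⊕-congʳ (Σ≤ n theta) (≋-trans (⊕-congˡ first last≋) (coeffwise λ N → sym (ℤP.*-distribˡ-+ (sgn (suc n)) _ _))) ⟩
    Σ≤ n theta ⊕ theta (suc n) ∎
    where
    open ≋-Reasoning
    first last : PS
    first = jacobiTerm (suc n) 0
    last = jacobiTerm (suc n) (suc (suc (n ℕ.+ n)))
    last≋ : last ≋ scale (sgn (suc n)) (qpow (b ℕ.* tri (suc n) ℕ.+ a ℕ.* suc n))
    last≋ = ≡⇒≋ (cong₂ (λ s e → scale s (qpow e))
      (trans (sgn-suc-suc ((n ℕ.+ n) ℕ.+ suc n)) (sgn-double-+ n (suc n)))
      (trans (cong (jacobiExp n) (sym (ℕP.+-suc n n))) (jacobiExp-diagonal n (suc n))))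

  theta-locallyFinite : 1 ≤ a → 1 ≤ c → LocallyFinite theta
  theta-locallyFinite 1≤a 1≤c zero    = vanishing λ _ ()
  theta-locallyFinite 1≤a 1≤c (suc k) = ∣-scale (sgn (suc k)) (∣-⊕
    (∣-weaken (jacobiExp-≥-right 1≤a 0 (suc k)) (q^k∣qpow _))
    (∣-weaken (ℕP.≤-trans (ℕP.m≤n*m (suc k) c ⦃ ℕ.>-nonZero 1≤c ⦄) (ℕP.m≤n+m (c ℕ.* suc k) (b ℕ.* tri (suc k)))) (q^k∣qpow _)))

  private
    2M<n⇒M≤n : ∀ {M n} → suc (M ℕ.+ M) ≤ n → M ≤ n
    2M<n⇒M≤n {M} 2M<n = ℕP.≤-trans (ℕP.m≤m+n M M) (ℕP.≤-trans (ℕP.n≤1+n (M ℕ.+ M)) 2M<n)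

    M<n∸j : ∀ M n j → suc (M ℕ.+ M) ≤ n → j < M → M < n ∸ j
    M<n∸j M n j 2M<n j<M = subst (_≤ n ∸ j) (ℕP.m+n∸n≡m (suc M) j) (ℕP.∸-monoˡ-≤ j M+j<n)
      where
      M+j<n : suc M ℕ.+ j ≤ n
      M+j<n = ℕP.≤-trans (ℕP.+-monoʳ-≤ (suc M) (ℕP.<⇒≤ j<M)) 2M<n

    M<j∸n : ∀ M n j → suc (M ℕ.+ M) ≤ n → j ≤ n ℕ.+ n → (n ℕ.+ n) ∸ j < M → M < j ∸ n
    M<j∸n M n j 2M<n j≤2n r<M = subst (_≤ j ∸ n) (ℕP.m+n∸n≡m (suc M) n) (ℕP.∸-monoˡ-≤ n M+n<j)
      where
      open ℕP.≤-Reasoning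
      r : ℕ
      r = (n ℕ.+ n) ∸ j
      M+n<j : suc M ℕ.+ n ≤ j
      M+n<j = ℕP.+-cancelʳ-≤ r (suc M ℕ.+ n) j (begin
        (suc M ℕ.+ n) ℕ.+ r ≡⟨ cong (ℕ._+ r) (ℕP.+-comm (suc M) n) ⟩
        (n ℕ.+ suc M) ℕ.+ r ≡⟨ ℕP.+-assoc n (suc M) r ⟩
        n ℕ.+ (suc M ℕ.+ r) ≤⟨ ℕP.+-monoʳ-≤ n (ℕP.≤-trans (ℕP.+-monoʳ-≤ (suc M) (ℕP.<⇒≤ r<M)) 2M<n) ⟩
        n ℕ.+ n             ≡⟨ ℕP.m∸n+n≡m j≤2n ⟨
        r ℕ.+ j             ≡⟨ ℕP.+-comm r j ⟩
        j ℕ.+ r             ∎)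

  private
    negligible : ∀ M n j {d} → d ≤ jacobiExp n j → M < d →
                 poch b b n ⊗ (jacobiTerm n j ⊗ gauss (n ℕ.+ n) j) ≈[ M ] jacobiTerm n j
    negligible M n j d≤e M<d = ≈-trans (∣⇒≈0 (∣⇒∣⊗ˡ (poch b b n) (∣⇒∣⊗ʳ (gauss (n ℕ.+ n) j) q∣term))) (≈-sym (∣⇒≈0 q∣term))
      where
      q∣term : q^ suc M ∣ jacobiTerm n j
      q∣term = ∣-scale (sgn (j ℕ.+ n)) (∣-weaken (ℕP.≤-trans M<d d≤e) (q^k∣qpow (jacobiExp n j)))

  -- For |j - n| ≤ M the factor (q^b; q^b)_n [2n, j] is ≡ 1, otherwise the term itself is ≡ 0, modulo q^(M+1).
  jacobiTerm-limit : 1 ≤ a → 1 ≤ c → ∀ M n j → suc (M ℕ.+ M) ≤ n → j ≤ n ℕ.+ n →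
                     poch b b n ⊗ (jacobiTerm n j ⊗ gauss (n ℕ.+ n) j) ≈[ M ] jacobiTerm n j
  jacobiTerm-limit 1≤a 1≤c M n j 2M<n j≤2n with M ℕ.≤? j | M ℕ.≤? (n ℕ.+ n) ∸ j
  ... | yes M≤j | yes M≤r = ≈-trans
    (≋⇒≈ (solve 3 (λ z x y → z :* (x :* y) := x :* (z :* y)) PS.refl (poch b b n) (jacobiTerm n j) (gauss (n ℕ.+ n) j)))
    (≈-trans (⊗-cong-≈ {f = jacobiTerm n j} ≈-refl poch⊗gauss≈1) (≋⇒≈ (⊗-identityʳ (jacobiTerm n j))))
    where
    1≤b : 1 ≤ b
    1≤b = ℕP.≤-trans 1≤a (ℕP.m≤m+n a c)
    poch⊗gauss≈1 : poch b b n ⊗ gauss (n ℕ.+ n) j ≈[ M ] one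
    poch⊗gauss≈1 = ≈-trans
      (⊗-cong-≈ (poch-stable b b n j 1≤b 1≤b (2M<n⇒M≤n 2M<n) M≤j) (≋⇒≈ (≡⇒≋ (cong (λ N → gauss N j) (sym (ℕP.m+[n∸m]≡n j≤2n))))))
      (poch-⊗-gauss-≈1 j ((n ℕ.+ n) ∸ j) 1≤b M≤r)
  ... | no M≰j | _        = negligible M n j (jacobiExp-≥-left 1≤c n j)
    (M<n∸j M n j 2M<n (ℕP.≰⇒> M≰j))
  ... | yes _  | no M≰r   = negligible M n j (jacobiExp-≥-right 1≤a n j)
    (M<j∸n M n j 2M<n j≤2n (ℕP.≰⇒> M≰r))

  jacobi-triple-product : 1 ≤ a → 1 ≤ c → ∀ M n → suc (M ℕ.+ M) ≤ n →
                          lsum theta ≈[ M ] (poch a b n ⊗ poch c b n) ⊗ poch b b n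
  jacobi-triple-product 1≤a 1≤c M n 2M<n = begin
    lsum theta
      ≈⟨ lsum-≈-Σ≤ (theta-locallyFinite 1≤a 1≤c) n (2M<n⇒M≤n 2M<n) ⟩
    Σ≤ n theta
      ≈⟨ ≋⇒≈ (Σ≤-jacobiTerm n) ⟨
    Σ≤ (n ℕ.+ n) (jacobiTerm n)
      ≈⟨ Σ≤-cong-≈ (n ℕ.+ n) (λ j j≤2n → jacobiTerm-limit 1≤a 1≤c M n j 2M<n j≤2n) ⟨
    Σ≤ (n ℕ.+ n) (λ j → poch b b n ⊗ (jacobiTerm n j ⊗ gauss (n ℕ.+ n) j))
      ≈⟨ ≋⇒≈ (⊗-Σ≤ (n ℕ.+ n) (poch b b n) (λ j → jacobiTerm n j ⊗ gauss (n ℕ.+ n) j)) ⟨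
    poch b b n ⊗ jacobiSum (n ℕ.+ n) n
      ≈⟨ ≋⇒≈ (≋-trans (⊗-congʳ (poch b b n) (finite-jacobi-triple-product n)) (⊗-comm (poch b b n) (poch a b n ⊗ poch c b n))) ⟩
    (poch a b n ⊗ poch c b n) ⊗ poch b b n ∎
    where open ≈-Reasoning M

-- The Rogers–Ramanujan identity

rrSumTerm : ℕ → ℕ → PS
rrSumTerm a n = qpow (n ℕ.* n ℕ.+ a ℕ.* n) ⊗ invQPoch n

rrSum : ℕ → PS
rrSum a = lsum (rrSumTerm a)

rrSumTerm-zero : ∀ a → rrSumTerm a 0 ≋ one
rrSumTerm-zero a = ≋-trans (⊗-congˡ one (≡⇒≋ (cong qpow (ℕP.*-zeroʳ a)))) (⊗-identityˡ one)

rrSumTerm-∣ : ∀ a m → q^ suc m ℕ.+ a ∣ rrSumTerm a (suc m)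
rrSumTerm-∣ a m = ∣⇒∣⊗ʳ (invQPoch (suc m)) (∣-weaken exponent≥ (q^k∣qpow (suc m ℕ.* suc m ℕ.+ a ℕ.* suc m)))
  where
  identity : ∀ a m → suc m ℕ.* suc m ℕ.+ a ℕ.* suc m ≡ (suc m ℕ.+ a) ℕ.+ (m ℕ.* suc m ℕ.+ a ℕ.* m)
  identity = solve-∀
  exponent≥ : suc m ℕ.+ a ≤ suc m ℕ.* suc m ℕ.+ a ℕ.* suc m
  exponent≥ = subst (suc m ℕ.+ a ≤_) (sym (identity a m)) (ℕP.m≤m+n (suc m ℕ.+ a) _)

rrSumTerm-locallyFinite : ∀ a → LocallyFinite (rrSumTerm a)
rrSumTerm-locallyFinite a zero    = vanishing λ _ ()
rrSumTerm-locallyFinite a (suc m) = ∣-weaken (ℕP.m≤m+n (suc m) a) (rrSumTerm-∣ a m)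

rrSum-≈1 : ∀ a → rrSum a ≈[ a ] one
rrSum-≈1 a = ≈-trans (lsum-≈-Σ≤ (rrSumTerm-locallyFinite a) a ℕP.≤-refl)
  (≈-trans (Σ≤-≈-head a (rrSumTerm a) (λ m → ∣⇒≈0 (∣-weaken (s≤s (ℕP.m≤n+m a m)) (rrSumTerm-∣ a m))))
           (≋⇒≈ (rrSumTerm-zero a)))

rrSumTerm-suc : ∀ a m → rrSumTerm a (suc m) ≋ rrSumTerm (suc a) (suc m) ⊕ (qpow (suc a) ⊗ rrSumTerm (suc (suc a)) m)
rrSumTerm-suc a m = begin
  A ⊗ (I ⊗ J)
    ≈⟨ solve 4 (λ A Y I J → A :* (I :* J) := (A :* Y) :* (I :* J) :+ (A :* I) :* ((con 1ℤ :- Y) :* J)) PS.refl A (qpow (suc m)) I J ⟩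
  ((A ⊗ qpow (suc m)) ⊗ (I ⊗ J)) ⊕ ((A ⊗ I) ⊗ (1-q^ suc m ⊗ J))
    ≈⟨ ⊕-congʳ ((A ⊗ qpow (suc m)) ⊗ (I ⊗ J)) (≋-trans (⊗-congʳ (A ⊗ I) (1-q^-inverse m)) (⊗-identityʳ (A ⊗ I))) ⟩
  ((A ⊗ qpow (suc m)) ⊗ (I ⊗ J)) ⊕ (A ⊗ I)
    ≈⟨ ⊕-cong (⊗-congˡ (I ⊗ J) (≋-trans (qpow-+ (suc m ℕ.* suc m ℕ.+ a ℕ.* suc m) (suc m)) (≡⇒≋ (cong qpow (identity₁ a m)))))
              (≋-trans (⊗-congˡ I (≋-trans (≡⇒≋ (cong qpow (identity₂ a m))) (≋-sym (qpow-+ (suc a) (m ℕ.* m ℕ.+ suc (suc a) ℕ.* m)))))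
                       (⊗-assoc (qpow (suc a)) (qpow (m ℕ.* m ℕ.+ suc (suc a) ℕ.* m)) I)) ⟩
  rrSumTerm (suc a) (suc m) ⊕ (qpow (suc a) ⊗ rrSumTerm (suc (suc a)) m) ∎
  where
  open ≋-Reasoning
  A I J : PS
  A = qpow (suc m ℕ.* suc m ℕ.+ a ℕ.* suc m)
  I = invQPoch m
  J = invOneMinusQpow m
  identity₁ : ∀ a m → (suc m ℕ.* suc m ℕ.+ a ℕ.* suc m) ℕ.+ suc m ≡ suc m ℕ.* suc m ℕ.+ suc a ℕ.* suc m
  identity₁ = solve-∀
  identity₂ : ∀ a m → suc m ℕ.* suc m ℕ.+ a ℕ.* suc m ≡ suc a ℕ.+ (m ℕ.* m ℕ.+ suc (suc a) ℕ.* m)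
  identity₂ = solve-∀

rrSum-recurrence : ∀ a → rrSum a ≋ rrSum (suc a) ⊕ (qpow (suc a) ⊗ rrSum (suc (suc a)))
rrSum-recurrence a = ≈⇒≋ truncated
  where
  G₀ G₁ G₂ : ℕ → PS
  G₀ = rrSumTerm a
  G₁ = rrSumTerm (suc a)
  G₂ = rrSumTerm (suc (suc a))
  partial : ∀ K → Σ≤ (suc K) G₀ ≋ Σ≤ (suc K) G₁ ⊕ (qpow (suc a) ⊗ Σ≤ K G₂)
  partial K = begin
    Σ≤ (suc K) G₀
      ≈⟨ Σ≤-suc K G₀ ⟩
    G₀ 0 ⊕ Σ≤ K (G₀ ∘ suc)
      ≈⟨ ⊕-cong (≋-trans (rrSumTerm-zero a) (≋-sym (rrSumTerm-zero (suc a)))) (Σ≤-cong K λ m _ → rrSumTerm-suc a m) ⟩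
    G₁ 0 ⊕ Σ≤ K (λ m → G₁ (suc m) ⊕ (qpow (suc a) ⊗ G₂ m))
      ≈⟨ ⊕-congʳ (G₁ 0) (Σ≤-⊕ K (G₁ ∘ suc) (λ m → qpow (suc a) ⊗ G₂ m)) ⟩
    G₁ 0 ⊕ (Σ≤ K (G₁ ∘ suc) ⊕ Σ≤ K (λ m → qpow (suc a) ⊗ G₂ m))
      ≈⟨ PS.+-assoc (G₁ 0) (Σ≤ K (G₁ ∘ suc)) _ ⟨
    (G₁ 0 ⊕ Σ≤ K (G₁ ∘ suc)) ⊕ Σ≤ K (λ m → qpow (suc a) ⊗ G₂ m)
      ≈⟨ ⊕-cong (Σ≤-suc K G₁) (⊗-Σ≤ K (qpow (suc a)) G₂) ⟨
    Σ≤ (suc K) G₁ ⊕ (qpow (suc a) ⊗ Σ≤ K G₂) ∎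
    where open ≋-Reasoning
  truncated : ∀ M → rrSum a ≈[ M ] rrSum (suc a) ⊕ (qpow (suc a) ⊗ rrSum (suc (suc a)))
  truncated M = begin
    rrSum a
      ≈⟨ lsum-≈-Σ≤ (rrSumTerm-locallyFinite a) (suc M) (ℕP.n≤1+n M) ⟩
    Σ≤ (suc M) G₀
      ≈⟨ ≋⇒≈ (partial M) ⟩
    Σ≤ (suc M) G₁ ⊕ (qpow (suc a) ⊗ Σ≤ M G₂)
      ≈⟨ ⊕-cong-≈ (lsum-≈-Σ≤ (rrSumTerm-locallyFinite (suc a)) (suc M) (ℕP.n≤1+n M))
                  (⊗-cong-≈ {f = qpow (suc a)} ≈-refl (lsum-≈-Σ≤ (rrSumTerm-locallyFinite (suc (suc a))) M ℕP.≤-refl)) ⟨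
    rrSum (suc a) ⊕ (qpow (suc a) ⊗ rrSum (suc (suc a))) ∎
    where open ≈-Reasoning M

rrCoeff : ℕ → PS
rrCoeff a = qpow (suc a) ⊗ (1-q^ suc a ⊗ 1-q^ suc (suc a))

IsRRSolution : (ℕ → PS) → Set
IsRRSolution F = ∀ a → F a ≋ (1-q^ suc a ⊗ F (suc a)) ⊕ (rrCoeff a ⊗ F (suc (suc a)))

-- Induction on k shows D a ≡ 0 modulo q^(M+1) whenever M ≤ k + a.
recurrence-≈0⇒≋0 : (D X Y : ℕ → PS) → (∀ a → D a ≋ (X a ⊗ D (suc a)) ⊕ (Y a ⊗ D (suc (suc a)))) →
                   (∀ a → D a ≈[ a ] 0ps) → ∀ a → D a ≋ 0ps
recurrence-≈0⇒≋0 D X Y recurrence initial a = ≈⇒≋ λ M → go M M a (ℕP.m≤m+n M a)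
  where
  go : ∀ M k a → M ≤ k ℕ.+ a → D a ≈[ M ] 0ps
  go M zero    a M≤a   = ≈-weaken M≤a (initial a)
  go M (suc k) a M≤k+a = ≈-trans (≋⇒≈ (recurrence a))
    (≈-trans (⊕-cong-≈ (⊗-cong-≈ {f = X a} ≈-refl (go M k (suc a) M≤k+a+1))
                       (⊗-cong-≈ {f = Y a} ≈-refl (go M k (suc (suc a)) (ℕP.≤-trans M≤k+a+1 (ℕP.+-monoʳ-≤ k (ℕP.n≤1+n (suc a)))))))
             (≋⇒≈ (solve 2 (λ x y → x :* con 0ℤ :+ y :* con 0ℤ := con 0ℤ) PS.refl (X a) (Y a))))
    where
    M≤k+a+1 : M ≤ k ℕ.+ suc a
    M≤k+a+1 = subst (M ≤_) (sym (ℕP.+-suc k a)) M≤k+a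

rrSolution-unique : ∀ {F G} → IsRRSolution F → IsRRSolution G →
                    (∀ a → F a ≈[ a ] one) → (∀ a → G a ≈[ a ] one) → F 0 ≋ G 0
rrSolution-unique {F} {G} F-sol G-sol F≈1 G≈1 =
  ≋-trans (solve 2 (λ f g → f := (f :- g) :+ g) PS.refl (F 0) (G 0))
    (≋-trans (⊕-congˡ (G 0) (recurrence-≈0⇒≋0 D (λ a → 1-q^ suc a) rrCoeff recurrence initial 0))
             (PS.+-identityˡ (G 0)))
  where
  D : ℕ → PS
  D a = F a ⊖ G a
  recurrence : ∀ a → D a ≋ (1-q^ suc a ⊗ D (suc a)) ⊕ (rrCoeff a ⊗ D (suc (suc a)))
  recurrence a = ≋-trans (⊖-cong (F-sol a) (G-sol a))
    (solve 6 (λ u v f₁ f₂ g₁ g₂ → ((u :* f₁) :+ (v :* f₂)) :- ((u :* g₁) :+ (v :* g₂)) := (u :* (f₁ :- g₁)) :+ (v :* (f₂ :- g₂)))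
      PS.refl (1-q^ suc a) (rrCoeff a) (F (suc a)) (F (suc (suc a))) (G (suc a)) (G (suc (suc a))))
  initial : ∀ a → D a ≈[ a ] 0ps
  initial a = ≈-trans (⊖-cong-≈ (F≈1 a) (G≈1 a)) (≋⇒≈ (PS.-‿inverseʳ one))

rrProduct : ℕ → PS
rrProduct a = poch∞ (suc a) ⊗ rrSum a

rrProduct-solution : IsRRSolution rrProduct
rrProduct-solution a = begin
  P₁ ⊗ rrSum a
    ≈⟨ ⊗-cong (poch∞-sucˡ (suc a) (s≤s z≤n)) (rrSum-recurrence a) ⟩
  (1-q^ suc a ⊗ P₂) ⊗ (G₁ ⊕ (qpow (suc a) ⊗ G₂))
    ≈⟨ solve 5 (λ o p g x h → (o :* p) :* (g :+ (x :* h)) := (o :* (p :* g)) :+ ((x :* o) :* (p :* h)))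
             PS.refl (1-q^ suc a) P₂ G₁ (qpow (suc a)) G₂ ⟩
  (1-q^ suc a ⊗ (P₂ ⊗ G₁)) ⊕ ((qpow (suc a) ⊗ 1-q^ suc a) ⊗ (P₂ ⊗ G₂))
    ≈⟨ ⊕-congʳ (1-q^ suc a ⊗ (P₂ ⊗ G₁)) (⊗-congʳ (qpow (suc a) ⊗ 1-q^ suc a) (⊗-congˡ G₂ (poch∞-sucˡ (suc (suc a)) (s≤s z≤n)))) ⟩
  (1-q^ suc a ⊗ (P₂ ⊗ G₁)) ⊕ ((qpow (suc a) ⊗ 1-q^ suc a) ⊗ ((1-q^ suc (suc a) ⊗ P₃) ⊗ G₂))
    ≈⟨ ⊕-congʳ (1-q^ suc a ⊗ (P₂ ⊗ G₁))
         (solve 5 (λ x o u r h → (x :* o) :* ((u :* r) :* h) := (x :* (o :* u)) :* (r :* h))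
                PS.refl (qpow (suc a)) (1-q^ suc a) (1-q^ suc (suc a)) P₃ G₂) ⟩
  (1-q^ suc a ⊗ rrProduct (suc a)) ⊕ (rrCoeff a ⊗ rrProduct (suc (suc a))) ∎
  where
  open ≋-Reasoning
  P₁ P₂ P₃ G₁ G₂ : PS
  P₁ = poch∞ (suc a)
  P₂ = poch∞ (suc (suc a))
  P₃ = poch∞ (suc (suc (suc a)))
  G₁ = rrSum (suc a)
  G₂ = rrSum (suc (suc a))

rrProduct-≈1 : ∀ a → rrProduct a ≈[ a ] one
rrProduct-≈1 a = ≈-trans
  (⊗-cong-≈ (≈-trans (poch∞-≈ (suc a) a (s≤s z≤n) ℕP.≤-refl) (poch-≈1 (suc a) 1 a ℕP.≤-refl)) (rrSum-≈1 a))
  (≋⇒≈ (⊗-identityˡ one))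

-- Sums of exponents, used to split a monomial into factors that the ring solver treats as atoms.
data Exponent : Set where
  ‵_   : ℕ → Exponent
  _‵+_ : Exponent → Exponent → Exponent

infixr 5 _‵+_
infix  6 ‵_

⟦_⟧ℕ : Exponent → ℕ
⟦ ‵ x ⟧ℕ    = x
⟦ e ‵+ f ⟧ℕ = ⟦ e ⟧ℕ ℕ.+ ⟦ f ⟧ℕ

⟦_⟧q : Exponent → PS
⟦ ‵ x ⟧q    = qpow x
⟦ e ‵+ f ⟧q = ⟦ e ⟧q ⊗ ⟦ f ⟧q

qpow-split : ∀ {x} e → x ≡ ⟦ e ⟧ℕ → qpow x ≋ ⟦ e ⟧q
qpow-split (‵ x)    refl = ≋-refl
qpow-split (e ‵+ f) refl = ≋-trans (≋-sym (qpow-+ ⟦ e ⟧ℕ ⟦ f ⟧ℕ)) (⊗-cong (qpow-split e refl) (qpow-split f refl))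

1-q^-split : ∀ {x} e → x ≡ ⟦ e ⟧ℕ → 1-q^ x ≋ one ⊖ ⟦ e ⟧q
1-q^-split e x≡e = ⊖-congʳ one (qpow-split e x≡e)

selbergExp : ℕ → ℕ → ℕ
selbergExp a n = 2 ℕ.* (a ℕ.* n) ℕ.+ (5 ℕ.* tri n ℕ.+ 2 ℕ.* n)

selbergTerm : ℕ → ℕ → PS
selbergTerm a zero    = one
selbergTerm a (suc m) = scale (sgn (suc m)) (qpow (selbergExp a (suc m)))
                        ⊗ ((1-q^ (a ℕ.+ 2 ℕ.* suc m) ⊗ poch (suc a) 1 m) ⊗ invQPoch (suc m))

selbergSeries : ℕ → PS
selbergSeries a = lsum (selbergTerm a)

-- The n-th term of W a − (1 − q^(a+1)) W (a+1) − rrCoeff a W (a+2) for W = selbergSeries;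
-- it telescopes against selbergRemainder.
selbergDefect : ℕ → ℕ → PS
selbergDefect a n = (selbergTerm a n ⊖ (1-q^ suc a ⊗ selbergTerm (suc a) n)) ⊖ (rrCoeff a ⊗ selbergTerm (suc (suc a)) n)

selbergRemainder : ℕ → ℕ → PS
selbergRemainder a zero    = 0ps
selbergRemainder a (suc m) = scale (sgn (suc m)) (qpow (selbergExp a (suc m)))
  ⊗ ((((one ⊕ qpow (suc m)) ⊖ qpow (a ℕ.+ 2 ℕ.* suc m)) ⊗ poch (suc a) 1 m) ⊗ invQPoch m)

selbergDefect-zero : ∀ a → selbergDefect a 0 ≋ selbergRemainder a 0 ⊖ selbergRemainder a 1
selbergDefect-zero a = begin
  (one ⊖ (1-q^ suc a ⊗ one)) ⊖ (rrCoeff a ⊗ one)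
    ≈⟨ ⊖-cong (⊖-congʳ one (⊗-congˡ one (1-q^-split (‵ 1 ‵+ ‵ a) refl)))
              (⊗-congˡ one (⊗-cong (qpow-split (‵ 1 ‵+ ‵ a) refl)
                                   (⊗-cong (1-q^-split (‵ 1 ‵+ ‵ a) refl) (1-q^-split (‵ 1 ‵+ ‵ 1 ‵+ ‵ a) refl)))) ⟩
  (one ⊖ ((one ⊖ (q ⊗ x)) ⊗ one)) ⊖ (((q ⊗ x) ⊗ ((one ⊖ (q ⊗ x)) ⊗ (one ⊖ (q ⊗ (q ⊗ x))))) ⊗ one)
    ≈⟨ solve 2 (λ q x → (con 1ℤ :- ((con 1ℤ :- (q :* x)) :* con 1ℤ)) :- (((q :* x) :* ((con 1ℤ :- (q :* x)) :* (con 1ℤ :- (q :* (q :* x))))) :* con 1ℤ)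
                := con 0ℤ :- ((con (- 1ℤ) :* (q :* (q :* (x :* x)))) :* ((((con 1ℤ :+ q) :- (q :* (q :* x))) :* con 1ℤ) :* con 1ℤ)))
             PS.refl q x ⟩
  0ps ⊖ ((scale (- 1ℤ) one ⊗ (q ⊗ (q ⊗ (x ⊗ x)))) ⊗ ((((one ⊕ q) ⊖ (q ⊗ (q ⊗ x))) ⊗ one) ⊗ one))
    ≈⟨ ⊖-congʳ 0ps (⊗-cong
         (≋-trans (⊗-congʳ (scale (- 1ℤ) one) (≋-sym (qpow-split (‵ 1 ‵+ ‵ 1 ‵+ ‵ a ‵+ ‵ a) (exponent a))))
                  (≋-sym (scale≋scale-one-⊗ (- 1ℤ) (qpow (selbergExp a 1)))))
         (⊗-congˡ one (⊗-congˡ one (⊖-congʳ (one ⊕ q) (≋-sym (qpow-split (‵ 1 ‵+ ‵ 1 ‵+ ‵ a) (ℕP.+-comm a 2))))))) ⟩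
  selbergRemainder a 0 ⊖ selbergRemainder a 1 ∎
  where
  open ≋-Reasoning
  q x : PS
  q = qpow 1
  x = qpow a
  exponent : ∀ a → 2 ℕ.* (a ℕ.* 1) ℕ.+ (5 ℕ.* 0 ℕ.+ 2 ℕ.* 1) ≡ 1 ℕ.+ (1 ℕ.+ (a ℕ.+ a))
  exponent = solve-∀

-- The three terms of selbergDefect a (m + 1) and the two remainders are brought into the form
-- F ⊗ (polynomial in q, Z = q^(a+n), Y = q^n); the telescoping is then one polynomial identity plus
-- 1-q^-inverse. Using Z rather than q^a keeps the degrees, and so the ring solver's work, small.
module SelbergDefectStep (a m : ℕ) where
  n : ℕ
  n = suc m

  S C X Y q Pa I J Z YY : PS
  S = scale (sgn n) one
  C = qpow (selbergExp a n)
  X = qpow a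
  Y = qpow n
  q = qpow 1
  Pa = poch (suc a) 1 m
  I = invQPoch m
  J = invOneMinusQpow m
  Z = X ⊗ Y
  YY = Y ⊗ Y

  private
    2n : ∀ a n → a ℕ.+ 2 ℕ.* n ≡ (a ℕ.+ n) ℕ.+ n
    2n = solve-∀
    shift₁ : ∀ a n t → 2 ℕ.* (suc a ℕ.* n) ℕ.+ (5 ℕ.* t ℕ.+ 2 ℕ.* n)
                     ≡ (2 ℕ.* (a ℕ.* n) ℕ.+ (5 ℕ.* t ℕ.+ 2 ℕ.* n)) ℕ.+ (n ℕ.+ n)
    shift₁ = solve-∀
    shift₂ : ∀ a n t → 2 ℕ.* (suc (suc a) ℕ.* n) ℕ.+ (5 ℕ.* t ℕ.+ 2 ℕ.* n)
                     ≡ (2 ℕ.* (a ℕ.* n) ℕ.+ (5 ℕ.* t ℕ.+ 2 ℕ.* n)) ℕ.+ ((n ℕ.+ n) ℕ.+ (n ℕ.+ n))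
    shift₂ = solve-∀
    step : ∀ a n t → 2 ℕ.* (a ℕ.* suc n) ℕ.+ (5 ℕ.* (t ℕ.+ n) ℕ.+ 2 ℕ.* suc n)
                   ≡ (2 ℕ.* (a ℕ.* n) ℕ.+ (5 ℕ.* t ℕ.+ 2 ℕ.* n)) ℕ.+ (1 ℕ.+ (1 ℕ.+ ((a ℕ.+ n) ℕ.+ ((a ℕ.+ n) ℕ.+ ((n ℕ.+ n) ℕ.+ n)))))
    step = solve-∀
    2suc : ∀ a n → a ℕ.+ 2 ℕ.* suc n ≡ 1 ℕ.+ (1 ℕ.+ ((a ℕ.+ n) ℕ.+ n))
    2suc = solve-∀
    start₁ : ∀ a m → suc a ℕ.+ 1 ℕ.* m ≡ a ℕ.+ suc m
    start₁ = solve-∀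
    start₂ : ∀ a m → suc (suc a) ℕ.+ 1 ℕ.* m ≡ 1 ℕ.+ (a ℕ.+ suc m)
    start₂ = solve-∀

    poch-shift : ∀ s → 1-q^ s ⊗ poch (suc s) 1 m ≋ poch s 1 m ⊗ 1-q^ (s ℕ.+ 1 ℕ.* m)
    poch-shift s = ≋-trans (⊗-congʳ (1-q^ s) (≡⇒≋ (cong (λ x → poch x 1 m) (ℕP.+-comm 1 s)))) (≋-sym (poch-sucˡ s 1 m))

  poch-shift₁ : 1-q^ suc a ⊗ poch (suc (suc a)) 1 m ≋ Pa ⊗ (one ⊖ Z)
  poch-shift₁ = ≋-trans (poch-shift (suc a)) (⊗-congʳ Pa (1-q^-split (‵ a ‵+ ‵ n) (start₁ a m)))

  poch-shift₂ : (1-q^ suc a ⊗ 1-q^ suc (suc a)) ⊗ poch (suc (suc (suc a))) 1 m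
                ≋ (Pa ⊗ (one ⊖ Z)) ⊗ (one ⊖ (q ⊗ Z))
  poch-shift₂ = begin
    (o₁ ⊗ o₂) ⊗ poch (suc (suc (suc a))) 1 m
      ≈⟨ ⊗-assoc o₁ o₂ (poch (suc (suc (suc a))) 1 m) ⟩
    o₁ ⊗ (o₂ ⊗ poch (suc (suc (suc a))) 1 m)
      ≈⟨ ⊗-congʳ o₁ (≋-trans (poch-shift (suc (suc a))) (⊗-congʳ (poch (suc (suc a)) 1 m) (1-q^-split (‵ 1 ‵+ ‵ a ‵+ ‵ n) (start₂ a m)))) ⟩
    o₁ ⊗ (poch (suc (suc a)) 1 m ⊗ (one ⊖ (q ⊗ Z)))
      ≈⟨ ⊗-assoc o₁ (poch (suc (suc a)) 1 m) (one ⊖ (q ⊗ Z)) ⟨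
    (o₁ ⊗ poch (suc (suc a)) 1 m) ⊗ (one ⊖ (q ⊗ Z))
      ≈⟨ ⊗-congˡ (one ⊖ (q ⊗ Z)) poch-shift₁ ⟩
    (Pa ⊗ (one ⊖ Z)) ⊗ (one ⊖ (q ⊗ Z)) ∎
    where
    open ≋-Reasoning
    o₁ o₂ : PS
    o₁ = 1-q^ suc a
    o₂ = 1-q^ suc (suc a)


  F f₀ f₁ f₂ g₀ r₁ : PS
  F  = S ⊗ (C ⊗ (Pa ⊗ (I ⊗ J)))
  f₀ = one ⊖ (Z ⊗ Y)
  f₁ = YY ⊗ ((one ⊖ (q ⊗ (Z ⊗ Y))) ⊗ (one ⊖ Z))
  f₂ = ((q ⊗ Z) ⊗ (Y ⊗ YY)) ⊗ ((one ⊖ (q ⊗ (q ⊗ (Z ⊗ Y)))) ⊗ ((one ⊖ Z) ⊗ (one ⊖ (q ⊗ Z))))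
  g₀ = (one ⊕ Y) ⊖ (Z ⊗ Y)
  r₁ = neg (q ⊗ (q ⊗ (Z ⊗ (Z ⊗ (YY ⊗ Y))))) ⊗ (((one ⊕ (q ⊗ Y)) ⊖ (q ⊗ (q ⊗ (Z ⊗ Y)))) ⊗ (one ⊖ Z))

  term₀ : selbergTerm a n ≋ F ⊗ f₀
  term₀ = begin
    scale (sgn n) C ⊗ ((1-q^ (a ℕ.+ 2 ℕ.* n) ⊗ Pa) ⊗ (I ⊗ J))
      ≈⟨ ⊗-cong (scale≋scale-one-⊗ (sgn n) C) (⊗-congˡ (I ⊗ J) (⊗-congˡ Pa (1-q^-split ((‵ a ‵+ ‵ n) ‵+ ‵ n) (2n a n)))) ⟩
    (S ⊗ C) ⊗ ((f₀ ⊗ Pa) ⊗ (I ⊗ J))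
      ≈⟨ rearrange 6 (λ s c f p i j → (s ∙ c) ∙ ((f ∙ p) ∙ (i ∙ j)) ⊜ (s ∙ (c ∙ (p ∙ (i ∙ j)))) ∙ f) PS.refl S C f₀ Pa I J ⟩
    F ⊗ f₀ ∎
    where open ≋-Reasoning

  term₁ : 1-q^ suc a ⊗ selbergTerm (suc a) n ≋ F ⊗ f₁
  term₁ = begin
    o₁ ⊗ (scale (sgn n) (qpow (selbergExp (suc a) n)) ⊗ ((1-q^ (suc a ℕ.+ 2 ℕ.* n) ⊗ Pa₁) ⊗ (I ⊗ J)))
      ≈⟨ ⊗-congʳ o₁ (⊗-cong (≋-trans (scale≋scale-one-⊗ (sgn n) (qpow (selbergExp (suc a) n)))
                                       (⊗-congʳ S (qpow-split (‵ selbergExp a n ‵+ ‵ n ‵+ ‵ n) (shift₁ a n (tri n)))))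
                             (⊗-congˡ (I ⊗ J) (⊗-congˡ Pa₁ (1-q^-split (‵ 1 ‵+ (‵ a ‵+ ‵ n) ‵+ ‵ n) (cong suc (2n a n)))))) ⟩
    o₁ ⊗ ((S ⊗ (C ⊗ YY)) ⊗ ((B ⊗ Pa₁) ⊗ (I ⊗ J)))
      ≈⟨ rearrange 8 (λ o s c y b p i j → o ∙ ((s ∙ (c ∙ y)) ∙ ((b ∙ p) ∙ (i ∙ j))) ⊜ (s ∙ (c ∙ ((o ∙ p) ∙ (i ∙ j)))) ∙ (y ∙ b))
                     PS.refl o₁ S C YY B Pa₁ I J ⟩
    (S ⊗ (C ⊗ ((o₁ ⊗ Pa₁) ⊗ (I ⊗ J)))) ⊗ (YY ⊗ B)
      ≈⟨ ⊗-congˡ (YY ⊗ B) (⊗-congʳ S (⊗-congʳ C (⊗-congˡ (I ⊗ J) poch-shift₁))) ⟩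
    (S ⊗ (C ⊗ ((Pa ⊗ (one ⊖ Z)) ⊗ (I ⊗ J)))) ⊗ (YY ⊗ B)
      ≈⟨ rearrange 8 (λ s c p d i j y b → (s ∙ (c ∙ ((p ∙ d) ∙ (i ∙ j)))) ∙ (y ∙ b) ⊜ (s ∙ (c ∙ (p ∙ (i ∙ j)))) ∙ (y ∙ (b ∙ d)))
                     PS.refl S C Pa (one ⊖ Z) I J YY B ⟩
    F ⊗ f₁ ∎
    where
    open ≋-Reasoning
    o₁ Pa₁ B : PS
    o₁ = 1-q^ suc a
    Pa₁ = poch (suc (suc a)) 1 m
    B = one ⊖ (q ⊗ (Z ⊗ Y))

  term₂ : rrCoeff a ⊗ selbergTerm (suc (suc a)) n ≋ F ⊗ f₂
  term₂ = begin
    (qpow (suc a) ⊗ o₁₂) ⊗ (scale (sgn n) (qpow (selbergExp (suc (suc a)) n)) ⊗ ((1-q^ (suc (suc a) ℕ.+ 2 ℕ.* n) ⊗ Pa₂) ⊗ (I ⊗ J)))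
      ≈⟨ ⊗-cong (⊗-congˡ o₁₂ (qpow-split (‵ 1 ‵+ ‵ a) refl))
                (⊗-cong (≋-trans (scale≋scale-one-⊗ (sgn n) (qpow (selbergExp (suc (suc a)) n)))
                                 (⊗-congʳ S (qpow-split (‵ selbergExp a n ‵+ (‵ n ‵+ ‵ n) ‵+ (‵ n ‵+ ‵ n)) (shift₂ a n (tri n)))))
                        (⊗-congˡ (I ⊗ J) (⊗-congˡ Pa₂ (1-q^-split (‵ 1 ‵+ ‵ 1 ‵+ (‵ a ‵+ ‵ n) ‵+ ‵ n) (cong (suc ∘ suc) (2n a n)))))) ⟩
    ((q ⊗ X) ⊗ o₁₂) ⊗ ((S ⊗ (C ⊗ (YY ⊗ YY))) ⊗ ((B ⊗ Pa₂) ⊗ (I ⊗ J)))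
      ≈⟨ rearrange 10 (λ q x y o s c b p i j → ((q ∙ x) ∙ o) ∙ ((s ∙ (c ∙ ((y ∙ y) ∙ (y ∙ y)))) ∙ ((b ∙ p) ∙ (i ∙ j)))
                                              ⊜ (s ∙ (c ∙ ((o ∙ p) ∙ (i ∙ j)))) ∙ (((q ∙ (x ∙ y)) ∙ (y ∙ (y ∙ y))) ∙ b))
                      PS.refl q X Y o₁₂ S C B Pa₂ I J ⟩
    (S ⊗ (C ⊗ ((o₁₂ ⊗ Pa₂) ⊗ (I ⊗ J)))) ⊗ (Q₄ ⊗ B)
      ≈⟨ ⊗-congˡ (Q₄ ⊗ B) (⊗-congʳ S (⊗-congʳ C (⊗-congˡ (I ⊗ J) poch-shift₂))) ⟩
    (S ⊗ (C ⊗ (((Pa ⊗ D₁) ⊗ D₂) ⊗ (I ⊗ J)))) ⊗ (Q₄ ⊗ B)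
      ≈⟨ rearrange 9 (λ s c p d e i j k b → (s ∙ (c ∙ (((p ∙ d) ∙ e) ∙ (i ∙ j)))) ∙ (k ∙ b) ⊜ (s ∙ (c ∙ (p ∙ (i ∙ j)))) ∙ (k ∙ (b ∙ (d ∙ e))))
                     PS.refl S C Pa D₁ D₂ I J Q₄ B ⟩
    F ⊗ f₂ ∎
    where
    open ≋-Reasoning
    o₁₂ Pa₂ B D₁ D₂ Q₄ : PS
    o₁₂ = 1-q^ suc a ⊗ 1-q^ suc (suc a)
    Pa₂ = poch (suc (suc (suc a))) 1 m
    B = one ⊖ (q ⊗ (q ⊗ (Z ⊗ Y)))
    D₁ = one ⊖ Z
    D₂ = one ⊖ (q ⊗ Z)
    Q₄ = (q ⊗ Z) ⊗ (Y ⊗ YY)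

  remainder₀ : selbergRemainder a n ≋ (S ⊗ (C ⊗ (Pa ⊗ I))) ⊗ g₀
  remainder₀ = begin
    scale (sgn n) C ⊗ ((((one ⊕ Y) ⊖ qpow (a ℕ.+ 2 ℕ.* n)) ⊗ Pa) ⊗ I)
      ≈⟨ ⊗-cong (scale≋scale-one-⊗ (sgn n) C) (⊗-congˡ I (⊗-congˡ Pa (⊖-congʳ (one ⊕ Y) (qpow-split ((‵ a ‵+ ‵ n) ‵+ ‵ n) (2n a n))))) ⟩
    (S ⊗ C) ⊗ ((g₀ ⊗ Pa) ⊗ I)
      ≈⟨ rearrange 5 (λ s c g p i → (s ∙ c) ∙ ((g ∙ p) ∙ i) ⊜ (s ∙ (c ∙ (p ∙ i))) ∙ g) PS.refl S C g₀ Pa I ⟩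
    (S ⊗ (C ⊗ (Pa ⊗ I))) ⊗ g₀ ∎
    where open ≋-Reasoning

  remainder₁ : selbergRemainder a (suc n) ≋ F ⊗ r₁
  remainder₁ = begin
    scale (- sgn n) (qpow (selbergExp a (suc n))) ⊗ ((G ⊗ (Pa ⊗ 1-q^ (suc a ℕ.+ 1 ℕ.* m))) ⊗ (I ⊗ J))
      ≈⟨ ⊗-cong (≋-trans (scale-neg (sgn n) (qpow (selbergExp a (suc n))))
                         (≋-trans (scale≋scale-one-⊗ (sgn n) (neg (qpow (selbergExp a (suc n)))))
                                  (⊗-congʳ S (neg-cong (qpow-split (‵ selbergExp a n ‵+ K-exponent) (step a n (tri n)))))))
                (⊗-congˡ (I ⊗ J) (⊗-cong (⊕-cong (⊕-congʳ one (qpow-split (‵ 1 ‵+ ‵ n) refl))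
                                                 (neg-cong (qpow-split (‵ 1 ‵+ ‵ 1 ‵+ (‵ a ‵+ ‵ n) ‵+ ‵ n) (2suc a n))))
                                         (⊗-congʳ Pa (1-q^-split (‵ a ‵+ ‵ n) (start₁ a m))))) ⟩
    (S ⊗ neg (C ⊗ K)) ⊗ ((G₁ ⊗ (Pa ⊗ D₁)) ⊗ (I ⊗ J))
      ≈⟨ ⊗-congˡ ((G₁ ⊗ (Pa ⊗ D₁)) ⊗ (I ⊗ J)) (⊗-congʳ S (solve 2 (λ c k → :- (c :* k) := c :* (:- k)) PS.refl C K)) ⟩
    (S ⊗ (C ⊗ neg K)) ⊗ ((G₁ ⊗ (Pa ⊗ D₁)) ⊗ (I ⊗ J))
      ≈⟨ rearrange 8 (λ s c k g p d i j → (s ∙ (c ∙ k)) ∙ ((g ∙ (p ∙ d)) ∙ (i ∙ j)) ⊜ (s ∙ (c ∙ (p ∙ (i ∙ j)))) ∙ (k ∙ (g ∙ d)))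
                     PS.refl S C (neg K) G₁ Pa D₁ I J ⟩
    F ⊗ r₁ ∎
    where
    open ≋-Reasoning
    G G₁ D₁ K : PS
    K-exponent : Exponent
    G = (one ⊕ qpow (suc n)) ⊖ qpow (a ℕ.+ 2 ℕ.* suc n)
    G₁ = (one ⊕ (q ⊗ Y)) ⊖ (q ⊗ (q ⊗ (Z ⊗ Y)))
    D₁ = one ⊖ Z
    K = q ⊗ (q ⊗ (Z ⊗ (Z ⊗ (YY ⊗ Y))))
    K-exponent = ‵ 1 ‵+ ‵ 1 ‵+ (‵ a ‵+ ‵ n) ‵+ (‵ a ‵+ ‵ n) ‵+ (‵ n ‵+ ‵ n) ‵+ ‵ n

  core-identity : (f₀ ⊖ f₁) ⊖ f₂ ≋ (g₀ ⊗ (one ⊖ Y)) ⊖ r₁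
  core-identity = solve 3 (λ q z y →
      ((con 1ℤ :- z :* y)
        :- (y :* y) :* ((con 1ℤ :- q :* (z :* y)) :* (con 1ℤ :- z)))
        :- ((q :* z) :* (y :* (y :* y))) :* ((con 1ℤ :- q :* (q :* (z :* y)))
                                             :* ((con 1ℤ :- z) :* (con 1ℤ :- q :* z)))
    := (((con 1ℤ :+ y) :- z :* y) :* (con 1ℤ :- y))
        :- (:- (q :* (q :* (z :* (z :* ((y :* y) :* y))))))
             :* (((con 1ℤ :+ q :* y) :- q :* (q :* (z :* y))) :* (con 1ℤ :- z)))
    PS.refl q Z Y

  selbergDefect-suc : selbergDefect a n ≋ selbergRemainder a n ⊖ selbergRemainder a (suc n)
  selbergDefect-suc = begin
    selbergDefect a n
      ≈⟨ ⊖-cong (⊖-cong term₀ term₁) term₂ ⟩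
    ((F ⊗ f₀) ⊖ (F ⊗ f₁)) ⊖ (F ⊗ f₂)
      ≈⟨ solve 4 (λ F a b c → (F :* a :- F :* b) :- F :* c := F :* ((a :- b) :- c)) PS.refl F f₀ f₁ f₂ ⟩
    F ⊗ ((f₀ ⊖ f₁) ⊖ f₂)
      ≈⟨ ⊗-congʳ F core-identity ⟩
    F ⊗ ((g₀ ⊗ (one ⊖ Y)) ⊖ r₁)
      ≈⟨ solve 4 (λ F g o r → F :* (g :* o :- r) := F :* (g :* o) :- F :* r) PS.refl F g₀ (one ⊖ Y) r₁ ⟩
    (F ⊗ (g₀ ⊗ (one ⊖ Y))) ⊖ (F ⊗ r₁)
      ≈⟨ ⊖-cong telescoped (≋-sym remainder₁) ⟩
    selbergRemainder a n ⊖ selbergRemainder a (suc n) ∎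
    where
    open ≋-Reasoning
    telescoped : F ⊗ (g₀ ⊗ (one ⊖ Y)) ≋ selbergRemainder a n
    telescoped = begin
      F ⊗ (g₀ ⊗ 1-q^ n)
        ≈⟨ rearrange 7 (λ s c p i j g o → (s ∙ (c ∙ (p ∙ (i ∙ j)))) ∙ (g ∙ o) ⊜ ((s ∙ (c ∙ (p ∙ i))) ∙ g) ∙ (o ∙ j))
                       PS.refl S C Pa I J g₀ (1-q^ n) ⟩
      ((S ⊗ (C ⊗ (Pa ⊗ I))) ⊗ g₀) ⊗ (1-q^ n ⊗ J)
        ≈⟨ ≋-trans (⊗-congʳ ((S ⊗ (C ⊗ (Pa ⊗ I))) ⊗ g₀) (1-q^-inverse m)) (⊗-identityʳ _) ⟩
      (S ⊗ (C ⊗ (Pa ⊗ I))) ⊗ g₀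
        ≈⟨ remainder₀ ⟨
      selbergRemainder a n ∎

selbergDefect-telescopes : ∀ a n → selbergDefect a n ≋ selbergRemainder a n ⊖ selbergRemainder a (suc n)
selbergDefect-telescopes a zero    = selbergDefect-zero a
selbergDefect-telescopes a (suc m) = SelbergDefectStep.selbergDefect-suc a m

Σ≤-selbergDefect : ∀ a K → Σ≤ K (selbergDefect a) ≋ (Σ≤ K (selbergTerm a) ⊖ (1-q^ suc a ⊗ Σ≤ K (selbergTerm (suc a))))
                                       ⊖ (rrCoeff a ⊗ Σ≤ K (selbergTerm (suc (suc a))))
Σ≤-selbergDefect a zero    = ≋-refl
Σ≤-selbergDefect a (suc K) = ≋-trans (⊕-congˡ (selbergDefect a (suc K)) (Σ≤-selbergDefect a K))
  (solve 8 (λ w w₁ w₂ u v x x₁ x₂ → ((w :- u :* w₁) :- v :* w₂) :+ ((x :- u :* x₁) :- v :* x₂)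
                                    := ((w :+ x) :- u :* (w₁ :+ x₁)) :- v :* (w₂ :+ x₂))
     PS.refl (Σ≤ K (selbergTerm a)) (Σ≤ K (selbergTerm (suc a))) (Σ≤ K (selbergTerm (suc (suc a))))
             (1-q^ suc a) (rrCoeff a) (selbergTerm a (suc K)) (selbergTerm (suc a) (suc K)) (selbergTerm (suc (suc a)) (suc K)))

signed-monomial-⊗-∣ : ∀ s e f {k} → k ≤ e → q^ k ∣ scale s (qpow e) ⊗ f
signed-monomial-⊗-∣ s e f k≤e = ∣⇒∣⊗ʳ f (∣-scale s (∣-weaken k≤e (q^k∣qpow e)))

selbergExp-≥ : ∀ a m → suc m ℕ.+ a ≤ selbergExp a (suc m)
selbergExp-≥ a m = subst (suc m ℕ.+ a ≤_) (sym (identity a m (tri m))) (ℕP.m≤m+n (suc m ℕ.+ a) _)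
  where
  identity : ∀ a m t → 2 ℕ.* (a ℕ.* suc m) ℕ.+ (5 ℕ.* (t ℕ.+ m) ℕ.+ 2 ℕ.* suc m)
                     ≡ (suc m ℕ.+ a) ℕ.+ (1 ℕ.+ a ℕ.+ 2 ℕ.* (a ℕ.* m) ℕ.+ 5 ℕ.* t ℕ.+ 6 ℕ.* m)
  identity = solve-∀

selbergTerm-∣ : ∀ a m → q^ suc m ℕ.+ a ∣ selbergTerm a (suc m)
selbergTerm-∣ a m = signed-monomial-⊗-∣ (sgn (suc m)) (selbergExp a (suc m))
  ((1-q^ (a ℕ.+ 2 ℕ.* suc m) ⊗ poch (suc a) 1 m) ⊗ invQPoch (suc m)) (selbergExp-≥ a m)

selbergTerm-locallyFinite : ∀ a → LocallyFinite (selbergTerm a)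
selbergTerm-locallyFinite a zero    = vanishing λ _ ()
selbergTerm-locallyFinite a (suc m) = ∣-weaken (ℕP.m≤m+n (suc m) a) (selbergTerm-∣ a m)

selbergSeries-≈1 : ∀ a → selbergSeries a ≈[ a ] one
selbergSeries-≈1 a = ≈-trans (lsum-≈-Σ≤ (selbergTerm-locallyFinite a) a ℕP.≤-refl)
  (Σ≤-≈-head a (selbergTerm a) (λ m → ∣⇒≈0 (∣-weaken (s≤s (ℕP.m≤n+m a m)) (selbergTerm-∣ a m))))

selbergSeries-solution : IsRRSolution selbergSeries
selbergSeries-solution a = ≈⇒≋ truncated
  where
  W₀ W₁ W₂ : ℕ → PS
  W₀ = selbergTerm a
  W₁ = selbergTerm (suc a)
  W₂ = selbergTerm (suc (suc a))
  truncated : ∀ M → selbergSeries a ≈[ M ] (1-q^ suc a ⊗ selbergSeries (suc a)) ⊕ (rrCoeff a ⊗ selbergSeries (suc (suc a)))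
  truncated M = begin
    selbergSeries a
      ≈⟨ lsum-≈-Σ≤ (selbergTerm-locallyFinite a) M ℕP.≤-refl ⟩
    Σ≤ M W₀
      ≈⟨ ≋⇒≈ (solve 5 (λ w w₁ w₂ u v → w := ((w :- u :* w₁) :- v :* w₂) :+ (u :* w₁ :+ v :* w₂))
                      PS.refl (Σ≤ M W₀) (Σ≤ M W₁) (Σ≤ M W₂) (1-q^ suc a) (rrCoeff a)) ⟩
    ((Σ≤ M W₀ ⊖ (1-q^ suc a ⊗ Σ≤ M W₁)) ⊖ (rrCoeff a ⊗ Σ≤ M W₂)) ⊕ ((1-q^ suc a ⊗ Σ≤ M W₁) ⊕ (rrCoeff a ⊗ Σ≤ M W₂))
      ≈⟨ ⊕-cong-≈ (≋⇒≈ (≋-trans (≋-sym (Σ≤-selbergDefect a M))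
                                 (≋-trans (Σ≤-cong M (λ n _ → selbergDefect-telescopes a n)) (Σ≤-telescope M (selbergRemainder a))))) ≈-refl ⟩
    (0ps ⊖ selbergRemainder a (suc M)) ⊕ ((1-q^ suc a ⊗ Σ≤ M W₁) ⊕ (rrCoeff a ⊗ Σ≤ M W₂))
      ≈⟨ ⊕-cong-≈ (⊖-cong-≈ {f = 0ps} ≈-refl (∣⇒≈0 (signed-monomial-⊗-∣ (sgn (suc M)) (selbergExp a (suc M)) R
                                                            (ℕP.≤-trans (ℕP.m≤m+n (suc M) a) (selbergExp-≥ a M)))))
                  (⊕-cong-≈ (⊗-cong-≈ {f = 1-q^ suc a} ≈-refl (≈-sym (lsum-≈-Σ≤ (selbergTerm-locallyFinite (suc a)) M ℕP.≤-refl)))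
                            (⊗-cong-≈ {f = rrCoeff a} ≈-refl (≈-sym (lsum-≈-Σ≤ (selbergTerm-locallyFinite (suc (suc a))) M ℕP.≤-refl)))) ⟩
    (0ps ⊖ 0ps) ⊕ ((1-q^ suc a ⊗ selbergSeries (suc a)) ⊕ (rrCoeff a ⊗ selbergSeries (suc (suc a))))
      ≈⟨ ≋⇒≈ (solve 2 (λ x y → (con 0ℤ :- con 0ℤ) :+ (x :+ y) := x :+ y) PS.refl
                      (1-q^ suc a ⊗ selbergSeries (suc a)) (rrCoeff a ⊗ selbergSeries (suc (suc a)))) ⟩
    (1-q^ suc a ⊗ selbergSeries (suc a)) ⊕ (rrCoeff a ⊗ selbergSeries (suc (suc a))) ∎
    where
    open ≈-Reasoning M
    R : PS
    R = (((one ⊕ qpow (suc M)) ⊖ qpow (a ℕ.+ 2 ℕ.* suc M)) ⊗ poch (suc a) 1 M) ⊗ invQPoch M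

selbergSeries≋rrProduct : selbergSeries 0 ≋ rrProduct 0
selbergSeries≋rrProduct = rrSolution-unique selbergSeries-solution rrProduct-solution selbergSeries-≈1 rrProduct-≈1

open JacobiTripleProduct using (theta; jacobi-triple-product)

selbergTerm-zero≋theta : ∀ n → selbergTerm 0 n ≋ theta 2 3 n
selbergTerm-zero≋theta zero    = ≋-refl
selbergTerm-zero≋theta (suc m) = begin
  scale s C ⊗ ((1-q^ (2 ℕ.* n) ⊗ Pm) ⊗ invQPoch n)
    ≈⟨ ⊗-cong (scale≋scale-one-⊗ s C) (⊗-congˡ (invQPoch n) (⊗-congˡ Pm (1-q^-split (‵ n ‵+ ‵ n) (cong (n ℕ.+_) (ℕP.+-identityʳ n))))) ⟩
  (S ⊗ C) ⊗ (((one ⊖ (Y ⊗ Y)) ⊗ Pm) ⊗ invQPoch n)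
    ≈⟨ solve 5 (λ s c y p i → (s :* c) :* (((con 1ℤ :- (y :* y)) :* p) :* i) := (s :* (c :+ (c :* y))) :* (i :* (p :* (con 1ℤ :- y))))
             PS.refl S C Y Pm (invQPoch n) ⟩
  (S ⊗ (C ⊕ (C ⊗ Y))) ⊗ (invQPoch n ⊗ (Pm ⊗ 1-q^ n))
    ≈⟨ ≋-trans (⊗-congʳ (S ⊗ (C ⊕ (C ⊗ Y))) (≋-trans (⊗-congʳ (invQPoch n) (⊗-congʳ Pm (≡⇒≋ (cong (λ k → 1-q^ suc k) (sym (ℕP.*-identityˡ m))))))
                                                       (invQPoch-inverse n)))
               (⊗-identityʳ (S ⊗ (C ⊕ (C ⊗ Y)))) ⟩
  S ⊗ (C ⊕ (C ⊗ Y))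
    ≈⟨ scale≋scale-one-⊗ s (C ⊕ (C ⊗ Y)) ⟨
  scale s (C ⊕ (C ⊗ Y))
    ≈⟨ scale-cong s (⊕-cong (≡⇒≋ (cong qpow (exponent₂ m (tri m))))
                            (≋-trans (qpow-+ (selbergExp 0 n) n) (≡⇒≋ (cong qpow (exponent₃ m (tri m)))))) ⟩
  theta 2 3 (suc m) ∎
  where
  open ≋-Reasoning
  n : ℕ
  s : ℤ
  S C Y Pm : PS
  n = suc m
  s = sgn n
  S = scale s one
  C = qpow (selbergExp 0 n)
  Y = qpow n
  Pm = poch 1 1 m
  exponent₂ : ∀ m t → 2 ℕ.* (0 ℕ.* suc m) ℕ.+ (5 ℕ.* (t ℕ.+ m) ℕ.+ 2 ℕ.* suc m) ≡ 5 ℕ.* (t ℕ.+ m) ℕ.+ 2 ℕ.* suc m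
  exponent₂ = solve-∀
  exponent₃ : ∀ m t → 2 ℕ.* (0 ℕ.* suc m) ℕ.+ (5 ℕ.* (t ℕ.+ m) ℕ.+ 2 ℕ.* suc m) ℕ.+ suc m ≡ 5 ℕ.* (t ℕ.+ m) ℕ.+ 3 ℕ.* suc m
  exponent₃ = solve-∀

rogers-ramanujan : poch∞ 1 ⊗ rrSum 0 ≋ lsum (theta 2 3)
rogers-ramanujan = ≋-trans (≋-sym selbergSeries≋rrProduct) (lsum-cong selbergTerm-zero≋theta)

RR≋rrSum : RR ≋ rrSum 0
RR≋rrSum = lsum-cong λ n → ⊗-congˡ (invQPoch n) (≡⇒≋ (cong qpow (sym (ℕP.+-identityʳ (n ℕ.* n)))))

half : ∀ {x} y → x ≡ y ℕ.* 2 → x ℕ./ 2 ≡ y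
half y refl = ℕD.m*n/n≡m y 2

P₇ : ∀ k → P 7 (suc k) ≡ 5 ℕ.* tri (suc k) ℕ.+ 1 ℕ.* suc k
P₇ k = half (5 ℕ.* tri (suc k) ℕ.+ 1 ℕ.* suc k) (begin
  suc k ℕ.* (5 ℕ.* suc k ∸ 3)               ≡⟨ cong (λ x → suc k ℕ.* (x ∸ 3)) (e₁ k) ⟩
  suc k ℕ.* (3 ℕ.+ (5 ℕ.* k ℕ.+ 2) ∸ 3)     ≡⟨ cong (suc k ℕ.*_) (ℕP.m+n∸m≡n 3 (5 ℕ.* k ℕ.+ 2)) ⟩
  suc k ℕ.* (5 ℕ.* k ℕ.+ 2)                 ≡⟨ e₂ k ⟩
  5 ℕ.* (k ℕ.* k) ℕ.+ (7 ℕ.* k ℕ.+ 2)       ≡⟨ cong (λ x → 5 ℕ.* x ℕ.+ (7 ℕ.* k ℕ.+ 2)) (tri-*2 k) ⟨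
  5 ℕ.* (tri k ℕ.* 2 ℕ.+ k) ℕ.+ (7 ℕ.* k ℕ.+ 2) ≡⟨ e₃ (tri k) k ⟩
  (5 ℕ.* (tri k ℕ.+ k) ℕ.+ 1 ℕ.* suc k) ℕ.* 2 ∎)
  where
  open ≡-Reasoning
  e₁ : ∀ k → 5 ℕ.* suc k ≡ 3 ℕ.+ (5 ℕ.* k ℕ.+ 2)
  e₁ = solve-∀
  e₂ : ∀ k → suc k ℕ.* (5 ℕ.* k ℕ.+ 2) ≡ 5 ℕ.* (k ℕ.* k) ℕ.+ (7 ℕ.* k ℕ.+ 2)
  e₂ = solve-∀
  e₃ : ∀ t k → 5 ℕ.* (t ℕ.* 2 ℕ.+ k) ℕ.+ (7 ℕ.* k ℕ.+ 2) ≡ (5 ℕ.* (t ℕ.+ k) ℕ.+ 1 ℕ.* suc k) ℕ.* 2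
  e₃ = solve-∀

Q₇ : ∀ m → Q 7 m ≡ 5 ℕ.* tri m ℕ.+ 4 ℕ.* m
Q₇ m = half (5 ℕ.* tri m ℕ.+ 4 ℕ.* m) (begin
  m ℕ.* (5 ℕ.* m ℕ.+ 3)               ≡⟨ e₁ m ⟩
  5 ℕ.* (m ℕ.* m) ℕ.+ 3 ℕ.* m         ≡⟨ cong (λ x → 5 ℕ.* x ℕ.+ 3 ℕ.* m) (tri-*2 m) ⟨
  5 ℕ.* (tri m ℕ.* 2 ℕ.+ m) ℕ.+ 3 ℕ.* m ≡⟨ e₂ (tri m) m ⟩
  (5 ℕ.* tri m ℕ.+ 4 ℕ.* m) ℕ.* 2     ∎)
  where
  open ≡-Reasoning
  e₁ : ∀ m → m ℕ.* (5 ℕ.* m ℕ.+ 3) ≡ 5 ℕ.* (m ℕ.* m) ℕ.+ 3 ℕ.* m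
  e₁ = solve-∀
  e₂ : ∀ t m → 5 ℕ.* (t ℕ.* 2 ℕ.+ m) ℕ.+ 3 ℕ.* m ≡ (5 ℕ.* t ℕ.+ 4 ℕ.* m) ℕ.* 2
  e₂ = solve-∀

5P₅ : ∀ k → 5 ℕ.* P 5 (suc k) ≡ 15 ℕ.* tri (suc k) ℕ.+ 5 ℕ.* suc k
5P₅ k = trans (cong (5 ℕ.*_) (half (3 ℕ.* tri (suc k) ℕ.+ suc k) (begin
  suc k ℕ.* (3 ℕ.* suc k ∸ 1)          ≡⟨ e₁ k ⟩
  3 ℕ.* (k ℕ.* k) ℕ.+ (5 ℕ.* k ℕ.+ 2)  ≡⟨ cong (λ x → 3 ℕ.* x ℕ.+ (5 ℕ.* k ℕ.+ 2)) (tri-*2 k) ⟨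
  3 ℕ.* (tri k ℕ.* 2 ℕ.+ k) ℕ.+ (5 ℕ.* k ℕ.+ 2) ≡⟨ e₂ (tri k) k ⟩
  (3 ℕ.* (tri k ℕ.+ k) ℕ.+ suc k) ℕ.* 2 ∎)))
  (e₃ (tri k) k)
  where
  open ≡-Reasoning
  e₁ : ∀ k → suc k ℕ.* (k ℕ.+ (suc k ℕ.+ (suc k ℕ.+ 0))) ≡ 3 ℕ.* (k ℕ.* k) ℕ.+ (5 ℕ.* k ℕ.+ 2)
  e₁ = solve-∀
  e₂ : ∀ t k → 3 ℕ.* (t ℕ.* 2 ℕ.+ k) ℕ.+ (5 ℕ.* k ℕ.+ 2) ≡ (3 ℕ.* (t ℕ.+ k) ℕ.+ suc k) ℕ.* 2
  e₂ = solve-∀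
  e₃ : ∀ t k → 5 ℕ.* (3 ℕ.* (t ℕ.+ k) ℕ.+ suc k) ≡ 15 ℕ.* (t ℕ.+ k) ℕ.+ 5 ℕ.* suc k
  e₃ = solve-∀

5Q₅ : ∀ m → 5 ℕ.* Q 5 m ≡ 15 ℕ.* tri m ℕ.+ 10 ℕ.* m
5Q₅ m = trans (cong (5 ℕ.*_) (half (3 ℕ.* tri m ℕ.+ 2 ℕ.* m) (begin
  m ℕ.* (3 ℕ.* m ℕ.+ 1)            ≡⟨ e₁ m ⟩
  3 ℕ.* (m ℕ.* m) ℕ.+ m            ≡⟨ cong (λ x → 3 ℕ.* x ℕ.+ m) (tri-*2 m) ⟨
  3 ℕ.* (tri m ℕ.* 2 ℕ.+ m) ℕ.+ m  ≡⟨ e₂ (tri m) m ⟩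
  (3 ℕ.* tri m ℕ.+ 2 ℕ.* m) ℕ.* 2  ∎)))
  (e₃ (tri m) m)
  where
  open ≡-Reasoning
  e₁ : ∀ m → m ℕ.* (3 ℕ.* m ℕ.+ 1) ≡ 3 ℕ.* (m ℕ.* m) ℕ.+ m
  e₁ = solve-∀
  e₂ : ∀ t m → 3 ℕ.* (t ℕ.* 2 ℕ.+ m) ℕ.+ m ≡ (3 ℕ.* t ℕ.+ 2 ℕ.* m) ℕ.* 2
  e₂ = solve-∀
  e₃ : ∀ t m → 5 ℕ.* (3 ℕ.* t ℕ.+ 2 ℕ.* m) ≡ 15 ℕ.* t ℕ.+ 10 ℕ.* m
  e₃ = solve-∀

Theta7≋theta : Theta7 ≋ lsum (theta 1 4)
Theta7≋theta = lsum-cong λ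
  { zero    → ≋-refl
  ; (suc k) → scale-cong (sgn (suc k)) (⊕-cong (≡⇒≋ (cong qpow (P₇ k))) (≡⇒≋ (cong qpow (Q₇ (suc k))))) }

LHS≋theta : LHS ≋ lsum (theta 5 10)
LHS≋theta = lsum-cong λ
  { zero    → ≋-refl
  ; (suc k) → scale-cong (sgn (suc k)) (⊕-cong (≡⇒≋ (cong qpow (5P₅ k))) (≡⇒≋ (cong qpow (5Q₅ (suc k))))) }

product-mod-5 : ∀ n → ((poch 2 5 n ⊗ poch 3 5 n) ⊗ poch 5 5 n) ⊗ ((poch 1 5 n ⊗ poch 4 5 n) ⊗ poch 5 5 n)
                      ≋ poch 1 1 (n ℕ.* 5) ⊗ poch 5 5 n
product-mod-5 n = ≋-trans
  (rearrange 5 (λ a b c d e → ((b ∙ c) ∙ e) ∙ ((a ∙ d) ∙ e) ⊜ (((((ε ∙ a) ∙ b) ∙ c) ∙ d) ∙ e) ∙ e)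
             PS.refl (poch 1 5 n) (poch 2 5 n) (poch 3 5 n) (poch 4 5 n) (poch 5 5 n))
  (⊗-congˡ (poch 5 5 n) (≋-sym (poch-dissect 1 1 5 n)))

product-mod-15 : ∀ n → poch 5 5 (n ℕ.* 3) ≋ (poch 5 15 n ⊗ poch 10 15 n) ⊗ poch 15 15 n
product-mod-15 n = ≋-trans (poch-dissect 5 5 3 n)
  (⊗-congˡ (poch 15 15 n) (⊗-congˡ (poch 10 15 n) (⊗-identityˡ (poch 5 15 n))))

corollary3 : (N : ℕ) → LHS N ≡ (RR ⊗ Theta7) N
corollary3 N = sym (coeff≤ (⊗-cancelˡ-≈ (poch∞ 1) {RR ⊗ Theta7} {LHS} N refl (truncated N)) N ℕP.≤-refl)
  where
  truncated : ∀ M → poch∞ 1 ⊗ (RR ⊗ Theta7) ≈[ M ] poch∞ 1 ⊗ LHS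
  truncated M = begin
    poch∞ 1 ⊗ (RR ⊗ Theta7)
      ≈⟨ ≋⇒≈ (≋-trans (≋-sym (⊗-assoc (poch∞ 1) RR Theta7))
                      (⊗-cong (≋-trans (⊗-congʳ (poch∞ 1) RR≋rrSum) rogers-ramanujan) Theta7≋theta)) ⟩
    lsum (theta 2 3) ⊗ lsum (theta 1 4)
      ≈⟨ ⊗-cong-≈ (jacobi-triple-product 2 3 (s≤s z≤n) (s≤s z≤n) M n ℕP.≤-refl)
                  (jacobi-triple-product 1 4 (s≤s z≤n) (s≤s z≤n) M n ℕP.≤-refl) ⟩
    ((poch 2 5 n ⊗ poch 3 5 n) ⊗ poch 5 5 n) ⊗ ((poch 1 5 n ⊗ poch 4 5 n) ⊗ poch 5 5 n)
      ≈⟨ ≋⇒≈ (product-mod-5 n) ⟩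
    poch 1 1 (n ℕ.* 5) ⊗ poch 5 5 n
      ≈⟨ ⊗-cong-≈ (≈-sym (poch∞-≈ 1 (n ℕ.* 5) (s≤s z≤n) (ℕP.≤-trans M≤n (ℕP.m≤m*n n 5))))
                  (poch-stable 5 5 n (n ℕ.* 3) (s≤s z≤n) (s≤s z≤n) M≤n (ℕP.≤-trans M≤n (ℕP.m≤m*n n 3))) ⟩
    poch∞ 1 ⊗ poch 5 5 (n ℕ.* 3)
      ≈⟨ ≋⇒≈ (⊗-congʳ (poch∞ 1) (product-mod-15 n)) ⟩
    poch∞ 1 ⊗ ((poch 5 15 n ⊗ poch 10 15 n) ⊗ poch 15 15 n)
      ≈⟨ ⊗-cong-≈ {f = poch∞ 1} ≈-refl (≈-trans (≋⇒≈ LHS≋theta) (jacobi-triple-product 5 10 (s≤s z≤n) (s≤s z≤n) M n ℕP.≤-refl)) ⟨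
    poch∞ 1 ⊗ LHS ∎
    where
    open ≈-Reasoning M
    n : ℕ
    n = suc (M ℕ.+ M)
    M≤n : M ≤ n
    M≤n = ℕP.≤-trans (ℕP.m≤m+n M M) (ℕP.n≤1+n (M ℕ.+ M))
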